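{- (1) Let $\Gamma$ be a signed graph containing a path $v_1v_2v_3v_4v_5v_6$ whose four internal vertices $v_2,v_3,v_4,v_5$ all have degree $2$ in $\Gamma$. Let $\Gamma'$ be the signed graph obtained from $\Gamma$ by replacing this path with a new edge $v_1v_6$ whose sign is the product of the signs of the five edges of the path (i.e., deleting $v_2,\dots,v_5$ and adding the edge $v_1v_6$). Then $\eta(\Gamma)=\eta(\Gamma')$. (2) Let $C_t$ be a pendant cycle of $\Gamma$ with $\eta(C_t)=2$, and let $\Gamma'$ be the signed graph obtained from $\Gamma$ by replacing $C_t$ with a quadrangle (cycle on $4$ vertices) of nullity $2$ passing through the unique major vertex of $C_t$. Then $\eta(\Gamma)=\eta(\Gamma')$.
   Context: A signed graph $\Gamma=(G,\sigma)$ is a simple finite graph $G$ with a map $\sigma:E(G)\to\{+,-\}$; its adjacency matrix has entry $\sigma(v_iv_j)$ if $v_i\sim v_j$ and $0$ otherwise; $\eta(\Gamma)$ is the multiplicity of eigenvalue $0$ of this matrix, and the nullity of a cycle is that of the signed cycle with inherited signs. A major vertex is a vertex of degree at least $3$. A cycle $C$ of $\Gamma$ is pendant if it contains exactly one major vertex of $\Gamma$. -}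

module Defs where

open import Data.Nat using (ℕ; zero; suc; _<_; _≥_)
open import Data.Nat.DivMod using (_%_; m%n<n)
open import Data.Fin using (Fin; zero; suc; toℕ; fromℕ<; inject₁)
open import Data.Fin.Properties using (_≟_)
open import Data.Maybe using (Maybe; just; nothing)
open import Data.Rational using (ℚ; 0ℚ; 1ℚ; -_; _+_; _*_)
open import Data.Product using (Σ; ∃; _×_; _,_)
open import Data.Sum using (_⊎_)
open import Data.Empty using (⊥)
open import Relation.Nullary using (¬_; yes; no)
open import Relation.Binary.PropositionalEquality using (_≡_; _≢_)
open import Function.Definitions using (Injective)

data Sign : Set where
  pos neg : Sign

_·_ : Sign → Sign → Sign
pos · s = s
neg · pos = neg
neg · neg = pos

-- A raw signed adjacency relation on Fin n: nothing = no edge,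
-- just s = edge with sign s.
RawSigned : ℕ → Set
RawSigned n = Fin n → Fin n → Maybe Sign

record SignedGraph (n : ℕ) : Set where
  field
    adj    : RawSigned n
    sym    : ∀ i j → adj i j ≡ adj j i
    irrefl : ∀ i → adj i i ≡ nothing
open SignedGraph public

∑ : ∀ {n} → (Fin n → ℚ) → ℚ
∑ {zero}  f = 0ℚ
∑ {suc n} f = f zero + ∑ (λ i → f (suc i))

∑ℕ : ∀ {n} → (Fin n → ℕ) → ℕ
∑ℕ {zero}  f = 0
∑ℕ {suc n} f = f zero Data.Nat.+ ∑ℕ (λ i → f (suc i))

isEdge : Maybe Sign → ℕ
isEdge nothing  = 0
isEdge (just _) = 1

deg : ∀ {n} → SignedGraph n → Fin n → ℕ
deg Γ v = ∑ℕ (λ j → isEdge (adj Γ v j))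

entry : Maybe Sign → ℚ
entry nothing    = 0ℚ
entry (just pos) = 1ℚ
entry (just neg) = - 1ℚ

InKernel : ∀ {n} → RawSigned n → (Fin n → ℚ) → Set
InKernel A v = ∀ i → ∑ (λ j → entry (A i j) * v j) ≡ 0ℚ

LinIndep : ∀ {n k} → (Fin k → Fin n → ℚ) → Set
LinIndep {n} {k} u =
  ∀ (c : Fin k → ℚ) → (∀ j → ∑ (λ i → c i * u i j) ≡ 0ℚ) → ∀ i → c i ≡ 0ℚ

IsNullity : ∀ {n} → RawSigned n → ℕ → Set
IsNullity {n} A k =
  (Σ (Fin k → Fin n → ℚ) λ u → (∀ i → InKernel A (u i)) × LinIndep u)
  × (∀ (u : Fin (suc k) → Fin n → ℚ) → (∀ i → InKernel A (u i)) → ¬ LinIndep u)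

SameNullity : ∀ {n m} → RawSigned n → RawSigned m → Set
SameNullity A B = ∀ k → (IsNullity A k → IsNullity B k) × (IsNullity B k → IsNullity A k)

next : ∀ {k} → Fin (suc k) → Fin (suc k)
next {k} i = fromℕ< (m%n<n (suc (toℕ i)) (suc k))

-- the signed cycle on Fin t (t ≥ 3) with edges i ~ next i carrying
-- the sign e i
cycleAdj : ∀ {k} → (Fin (suc k) → Maybe Sign) → RawSigned (suc k)
cycleAdj e i j with j ≟ next i
... | yes _ = e i
... | no _ with i ≟ next j
...   | yes _ = e j
...   | no _  = nothing

Part1 : Set
Part1 =
  ∀ {n} (Γ : SignedGraph n)
    (v : Fin 6 → Fin n) → Injective _≡_ _≡_ v
  → (s : Fin 5 → Sign)
  → (∀ (i : Fin 5) → adj Γ (v (inject₁ i)) (v (suc i)) ≡ just (s i))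
  → (∀ (i : Fin 4) → deg Γ (v (suc (inject₁ i))) ≡ 2)
  → adj Γ (v zero) (v (suc (suc (suc (suc (suc zero)))))) ≡ nothing
  → let v₁ = v zero
        v₆ = v (suc (suc (suc (suc (suc zero)))))
        Internal : Fin n → Set
        Internal x = ∃ λ (i : Fin 4) → x ≡ v (suc (inject₁ i))
        σ = s zero · (s (suc zero) · (s (suc (suc zero)) ·
              (s (suc (suc (suc zero))) · s (suc (suc (suc (suc zero)))))))
    in
    ∀ {m} (Γ' : SignedGraph m) (f : Fin m → Fin n)
  → Injective _≡_ _≡_ f
  → (∀ i → ¬ Internal (f i))
  → (∀ x → ¬ Internal x → ∃ λ i → f i ≡ x)
  → (∀ i j → f i ≡ v₁ → f j ≡ v₆ → adj Γ' i j ≡ just σ)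
  → (∀ i j → ¬ (f i ≡ v₁ × f j ≡ v₆) → ¬ (f i ≡ v₆ × f j ≡ v₁)
           → adj Γ' i j ≡ adj Γ (f i) (f j))
  → SameNullity (adj Γ) (adj Γ')

Part2 : Set
Part2 =
  ∀ {n} (Γ : SignedGraph n) (k : ℕ)
    -- the cycle c₀ c₁ … c_{t-1} c₀, t = k + 3 ≥ 3
    (c : Fin (suc (suc (suc k))) → Fin n) → Injective _≡_ _≡_ c
  → (∀ i → adj Γ (c i) (c (next i)) ≢ nothing)
    -- pendant: exactly one major vertex, namely c p
  → (p : Fin (suc (suc (suc k))))
  → deg Γ (c p) ≥ 3
  → (∀ i → i ≢ p → deg Γ (c i) < 3)
  → IsNullity (cycleAdj (λ i → adj Γ (c i) (c (next i)))) 2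
    -- quadrangle w q₁ q₂ q₃ w (vertex 0 is w) with signs s, of nullity 2
  → (s : Fin 4 → Sign)
  → let Q = cycleAdj (λ i → just (s i))
        w = c p
        Removed : Fin n → Set
        Removed x = ∃ λ i → i ≢ p × x ≡ c i
    in
    -- Γ': vertices correspond via h to the non-removed old vertices
    -- (inj₁) and three new vertices q₁ q₂ q₃ (inj₂)
    ∀ {m} (Γ' : SignedGraph m) (h : Fin m → Fin n ⊎ Fin 3)
  → Injective _≡_ _≡_ h
  → (∀ i x → h i ≡ Data.Sum.inj₁ x → ¬ Removed x)
  → (∀ x → ¬ Removed x → ∃ λ i → h i ≡ Data.Sum.inj₁ x)
  → (∀ (q : Fin 3) → ∃ λ i → h i ≡ Data.Sum.inj₂ q)
  → (∀ i j x y → h i ≡ Data.Sum.inj₁ x → h j ≡ Data.Sum.inj₁ y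
       → adj Γ' i j ≡ adj Γ x y)
  → (∀ i j q → h i ≡ Data.Sum.inj₁ w → h j ≡ Data.Sum.inj₂ q
       → adj Γ' i j ≡ Q zero (suc q))
  → (∀ i j x q → h i ≡ Data.Sum.inj₁ x → x ≢ w → h j ≡ Data.Sum.inj₂ q
       → adj Γ' i j ≡ nothing)
  → (∀ i j q r → h i ≡ Data.Sum.inj₂ q → h j ≡ Data.Sum.inj₂ r
       → adj Γ' i j ≡ Q (suc q) (suc r))
  → IsNullity Q 2
  → SameNullity (adj Γ) (adj Γ')

-- Both parts are proved by a linear isomorphism between the kernels of the two adjacency matrices.
--
-- (1) Number the path v₀ … v₅ with signs s₀ … s₄ and σ = s₀ ⋯ s₄. The rows of the four inner vertices
-- express x(v₁), …, x(v₄) through x(v₀) and x(v₅) and force s₀ x(v₁) = σ x(v₅) and s₄ x(v₄) = σ x(v₀).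
-- These are exactly the terms by which the rows of v₀ and v₅ in Γ and in Γ′ differ, so restricting
-- a kernel vector to the surviving vertices is the isomorphism.
--
-- (2) On a cycle whose vertices other than p have degree two, the rows at those vertices propagate
-- the values at p and at its successor around the cycle. If the cycle has nullity two, every pair of
-- values is attained, and the row at p then holds automatically. Applied to C_t and to the quadrangle,
-- this shows that the rows of the major vertex in Γ and in Γ′ differ by two vanishing cycle rows, and
-- kernel vectors correspond by keeping the values off the cycle and filling in the quadrangle from the
-- values at the major vertex and its successor on C_t.

module Submission where

open import Defs hiding (sym)
open import Defs using () renaming (sym to adj-sym)

open import Algebra.Bundles using (CommutativeRing)
open import Data.Bool.Base using (if_then_else_)
open import Data.Fin.Base using (Fin; zero; suc; toℕ; inject₁; punchIn; punchOut)
open import Data.Fin.Patterns using (0F; 1F; 2F; 3F; 4F; 5F)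
import Data.Fin.Properties as Finₚ
open import Data.Maybe.Base using (Maybe; just; nothing)
open import Data.Nat.Base as ℕ using (ℕ; zero; suc; _≤_; _<_; _∸_; s≤s; z≤n)
open import Data.Nat.DivMod using (_%_; _/_; %-distribˡ-+; m%n%n≡m%n; [m+n]%n≡m%n; m<n⇒m%n≡m; m≡m%n+[m/n]*n)
import Data.Nat.Properties as ℕₚ
open import Data.Product.Base using (∃; _×_; _,_; proj₁; proj₂)
open import Data.Rational.Base using (ℚ; 0ℚ; 1ℚ; -_; _+_; _*_; _-_; 1/_; ≢-nonZero)
import Data.Rational.Properties as ℚₚ
open import Data.Sum.Base using (_⊎_; inj₁; inj₂)
import Data.Sum.Properties as ⊎ₚ
open import Data.Vec.Functional using (Vector; removeAt; _∷_; [])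
open import Function.Base using (_∘_; const)
open import Function.Definitions using (Injective)
open import Relation.Binary.Definitions using (DecidableEquality)
open import Relation.Binary.PropositionalEquality
open import Relation.Nullary.Decidable using (Dec; yes; no; does; dec-true; dec-false; dec⇒maybe; ¬?; _×-dec_)
open import Relation.Nullary.Negation using (¬_; contradiction)
open import Tactic.RingSolver using (solve-∀)
open import Tactic.RingSolver.Core.AlmostCommutativeRing using (AlmostCommutativeRing; fromCommutativeRing)

open import Algebra.Properties.Group ℚₚ.+-0-group using (inverseˡ-unique) renaming (∙-cancelʳ to +-cancelʳ)
import Algebra.Properties.Semiring.Sum (CommutativeRing.semiring ℚₚ.+-*-commutativeRing) as Sum
open Sum using (sum)
import Algebra.Properties.CommutativeMonoid.Sum ℕₚ.+-0-commutativeMonoid as ℕ-Sum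

private
  -- without a zero test the solver cannot discard cancelled monomials
  ℚ-ring : AlmostCommutativeRing _ _
  ℚ-ring = fromCommutativeRing ℚₚ.+-*-commutativeRing (λ x → dec⇒maybe (0ℚ ℚₚ.≟ x))

private
  variable
    k m n : ℕ

∑≡sum : (f : Vector ℚ n) → ∑ f ≡ sum f
∑≡sum {zero}  f = refl
∑≡sum {suc n} f = cong (f zero +_) (∑≡sum (f ∘ suc))

∑ℕ≡sum : (f : Vector ℕ n) → ∑ℕ f ≡ ℕ-Sum.sum f
∑ℕ≡sum {zero}  f = refl
∑ℕ≡sum {suc n} f = cong (f zero ℕ.+_) (∑ℕ≡sum (f ∘ suc))

∑-cong : {f g : Vector ℚ n} → f ≗ g → ∑ f ≡ ∑ g
∑-cong {f = f} {g} f≗g = trans (∑≡sum f) (trans (Sum.sum-cong-≗ f≗g) (sym (∑≡sum g)))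

∑-zero : {f : Vector ℚ n} → f ≗ const 0ℚ → ∑ f ≡ 0ℚ
∑-zero {n} f≗0 = trans (∑-cong f≗0) (trans (∑≡sum {n} (const 0ℚ)) (Sum.sum-replicate-zero n))

∑-+ : (f g : Vector ℚ n) → ∑ (λ j → f j + g j) ≡ ∑ f + ∑ g
∑-+ f g = trans (∑≡sum (λ j → f j + g j)) (trans (Sum.∑-distrib-+ f g) (sym (cong₂ _+_ (∑≡sum f) (∑≡sum g))))

∑-*ˡ : (a : ℚ) (f : Vector ℚ n) → a * ∑ f ≡ ∑ (λ j → a * f j)
∑-*ˡ a f = trans (cong (a *_) (∑≡sum f)) (trans (Sum.*-distribˡ-sum a f) (sym (∑≡sum (λ j → a * f j))))

∑-comm : (G : Fin m → Fin n → ℚ) → ∑ (λ i → ∑ (G i)) ≡ ∑ (λ j → ∑ (λ i → G i j))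
∑-comm G = trans (sums G) (trans (Sum.∑-comm G) (sym (sums (λ j i → G i j))))
  where
  sums : ∀ {m n} (H : Fin m → Fin n → ℚ) → ∑ (λ i → ∑ (H i)) ≡ sum (λ i → sum (H i))
  sums H = trans (∑-cong (λ i → ∑≡sum (H i))) (∑≡sum (λ i → sum (H i)))

∑-remove : (f : Vector ℚ (suc n)) (a : Fin (suc n)) → ∑ f ≡ f a + ∑ (removeAt f a)
∑-remove f a = trans (∑≡sum f) (trans (Sum.sum-remove {i = a} f) (cong (f a +_) (sym (∑≡sum (removeAt f a)))))

∑-single : {f : Vector ℚ n} (a : Fin n) → (∀ j → j ≢ a → f j ≡ 0ℚ) → ∑ f ≡ f a
∑-single {suc n} {f} a f≡0 = begin
  ∑ f                       ≡⟨ ∑-remove f a ⟩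
  f a + ∑ (removeAt f a)    ≡⟨ cong (f a +_) (∑-zero (λ j → f≡0 (punchIn a j) (Finₚ.punchInᵢ≢i a j))) ⟩
  f a + 0ℚ                  ≡⟨ ℚₚ.+-identityʳ (f a) ⟩
  f a                       ∎
  where open ≡-Reasoning

private module _ {a b : Fin (suc (suc n))} (a≢b : a ≢ b) where

  skip₂ : Fin n → Fin (suc (suc n))
  skip₂ j = punchIn a (punchIn (punchOut a≢b) j)

  skip₂≢ : ∀ j → skip₂ j ≢ a × skip₂ j ≢ b
  skip₂≢ j = Finₚ.punchInᵢ≢i a _ , λ eq → Finₚ.punchInᵢ≢i (punchOut a≢b) j
    (Finₚ.punchIn-injective a _ _ (trans eq (sym (Finₚ.punchIn-punchOut a≢b))))

  ∑-remove₂ : (f : Vector ℚ (suc (suc n))) → ∑ f ≡ f a + (f b + ∑ (f ∘ skip₂))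
  ∑-remove₂ f = trans (∑-remove f a) (cong (f a +_)
    (trans (∑-remove (removeAt f a) (punchOut a≢b)) (cong (_+ ∑ (f ∘ skip₂)) (cong f (Finₚ.punchIn-punchOut a≢b)))))

∑-pair : {f : Vector ℚ n} {a b : Fin n} → a ≢ b → (∀ j → j ≢ a → j ≢ b → f j ≡ 0ℚ) → ∑ f ≡ f a + f b
∑-pair {suc zero}    {a = zero} {zero} a≢b _ = contradiction refl a≢b
∑-pair {suc (suc n)} {f} {a} {b} a≢b f≡0 = begin
  ∑ f                             ≡⟨ ∑-remove₂ a≢b f ⟩
  f a + (f b + ∑ (f ∘ skip₂ a≢b)) ≡⟨ cong (λ t → f a + (f b + t)) (∑-zero λ j → f≡0 _ (proj₁ (skip₂≢ a≢b j)) (proj₂ (skip₂≢ a≢b j))) ⟩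
  f a + (f b + 0ℚ)                ≡⟨ cong (f a +_) (ℚₚ.+-identityʳ (f b)) ⟩
  f a + f b                       ∎
  where open ≡-Reasoning

∑-agree-except₂ : {f g : Vector ℚ n} {a b : Fin n} → a ≢ b → (∀ j → j ≢ a → j ≢ b → f j ≡ g j) →
                  ∑ f + (g a + g b) ≡ ∑ g + (f a + f b)
∑-agree-except₂ {suc zero}    {a = zero} {zero} a≢b _ = contradiction refl a≢b
∑-agree-except₂ {suc (suc n)} {f} {g} {a} {b} a≢b f≡g = begin
  ∑ f + (g a + g b)                            ≡⟨ cong (_+ (g a + g b)) (∑-remove₂ a≢b f) ⟩
  (f a + (f b + ∑ (f ∘ skip₂ a≢b))) + (g a + g b) ≡⟨ cong (λ t → (f a + (f b + t)) + (g a + g b)) rest ⟩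
  (f a + (f b + ∑ (g ∘ skip₂ a≢b))) + (g a + g b) ≡⟨ swap (f a) (f b) (g a) (g b) _ ⟩
  (g a + (g b + ∑ (g ∘ skip₂ a≢b))) + (f a + f b) ≡⟨ cong (_+ (f a + f b)) (∑-remove₂ a≢b g) ⟨
  ∑ g + (f a + f b)                            ∎
  where
  open ≡-Reasoning
  rest = ∑-cong (λ j → f≡g _ (proj₁ (skip₂≢ a≢b j)) (proj₂ (skip₂≢ a≢b j)))
  swap : ∀ w x y z r → (w + (x + r)) + (y + z) ≡ (y + (z + r)) + (w + x)
  swap = solve-∀ ℚ-ring

∑ℕ-remove : (f : Vector ℕ (suc n)) (a : Fin (suc n)) → ∑ℕ f ≡ f a ℕ.+ ∑ℕ (removeAt f a)
∑ℕ-remove f a = trans (∑ℕ≡sum f) (trans (ℕ-Sum.sum-remove {i = a} f) (cong (f a ℕ.+_) (sym (∑ℕ≡sum (removeAt f a)))))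

term≤∑ℕ : (f : Vector ℕ n) (a : Fin n) → f a ≤ ∑ℕ f
term≤∑ℕ {suc n} f a = subst (f a ≤_) (sym (∑ℕ-remove f a)) (ℕₚ.m≤m+n (f a) _)

two-terms≤∑ℕ : (f : Vector ℕ n) {a b : Fin n} → a ≢ b → f a ℕ.+ f b ≤ ∑ℕ f
two-terms≤∑ℕ {suc n} f {a} {b} a≢b = subst (f a ℕ.+ f b ≤_) (sym (∑ℕ-remove f a))
  (ℕₚ.+-monoʳ-≤ (f a) (subst (_≤ ∑ℕ (removeAt f a)) (cong f (Finₚ.punchIn-punchOut a≢b))
    (term≤∑ℕ (removeAt f a) (punchOut a≢b))))

three-terms≤∑ℕ : (f : Vector ℕ n) {a b c : Fin n} → a ≢ b → a ≢ c → b ≢ c → f a ℕ.+ (f b ℕ.+ f c) ≤ ∑ℕ f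
three-terms≤∑ℕ {suc n} f {a} {b} {c} a≢b a≢c b≢c = subst (f a ℕ.+ (f b ℕ.+ f c) ≤_) (sym (∑ℕ-remove f a))
  (ℕₚ.+-monoʳ-≤ (f a) (subst (_≤ ∑ℕ (removeAt f a))
    (cong₂ ℕ._+_ (cong f (Finₚ.punchIn-punchOut a≢b)) (cong f (Finₚ.punchIn-punchOut a≢c)))
    (two-terms≤∑ℕ (removeAt f a) (b≢c ∘ Finₚ.punchOut-injective a≢b a≢c))))

⟦_⟧ : Sign → ℚ
⟦ s ⟧ = entry (just s)

⟦·⟧ : ∀ s t → ⟦ s · t ⟧ ≡ ⟦ s ⟧ * ⟦ t ⟧
⟦·⟧ pos pos = refl
⟦·⟧ pos neg = refl
⟦·⟧ neg pos = refl
⟦·⟧ neg neg = refl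

⟦⟧² : ∀ s → ⟦ s ⟧ * ⟦ s ⟧ ≡ 1ℚ
⟦⟧² pos = refl
⟦⟧² neg = refl

⟦⟧-involutive : ∀ s x → ⟦ s ⟧ * (⟦ s ⟧ * x) ≡ x
⟦⟧-involutive s x = trans (sym (ℚₚ.*-assoc ⟦ s ⟧ ⟦ s ⟧ x)) (trans (cong (_* x) (⟦⟧² s)) (ℚₚ.*-identityˡ x))

entry-cancelˡ : ∀ {e x y} → e ≢ nothing → entry e * x ≡ entry e * y → x ≡ y
entry-cancelˡ {nothing} e≢nothing _ = contradiction refl e≢nothing
entry-cancelˡ {just s} {x} {y} _ eq =
  trans (sym (⟦⟧-involutive s x)) (trans (cong (⟦ s ⟧ *_) eq) (⟦⟧-involutive s y))

sign-solve : ∀ a b {x y} → ⟦ a ⟧ * x + ⟦ b ⟧ * y ≡ 0ℚ → y ≡ - (⟦ a ⟧ * ⟦ b ⟧ * x)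
sign-solve a b {x} {y} eq = begin
  y                                                  ≡⟨ ⟦⟧-involutive b y ⟨
  ⟦ b ⟧ * (⟦ b ⟧ * y)                                 ≡⟨ regroup ⟦ a ⟧ ⟦ b ⟧ x y ⟩
  ⟦ b ⟧ * (⟦ a ⟧ * x + ⟦ b ⟧ * y) - ⟦ a ⟧ * ⟦ b ⟧ * x  ≡⟨ cong (λ t → ⟦ b ⟧ * t - ⟦ a ⟧ * ⟦ b ⟧ * x) eq ⟩
  ⟦ b ⟧ * 0ℚ - ⟦ a ⟧ * ⟦ b ⟧ * x                      ≡⟨ cancel ⟦ a ⟧ ⟦ b ⟧ x ⟩
  - (⟦ a ⟧ * ⟦ b ⟧ * x)                               ∎
  where
  open ≡-Reasoning
  regroup : ∀ A B x y → B * (B * y) ≡ B * (A * x + B * y) - A * B * x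
  regroup = solve-∀ ℚ-ring
  cancel : ∀ A B x → B * 0ℚ - A * B * x ≡ - (A * B * x)
  cancel = solve-∀ ℚ-ring

sign-solution : ∀ a b x → ⟦ a ⟧ * x + ⟦ b ⟧ * (- (⟦ a ⟧ * ⟦ b ⟧ * x)) ≡ 0ℚ
sign-solution a b x = begin
  ⟦ a ⟧ * x + ⟦ b ⟧ * (- (⟦ a ⟧ * ⟦ b ⟧ * x))  ≡⟨ regroup ⟦ a ⟧ ⟦ b ⟧ x ⟩
  ⟦ a ⟧ * x - ⟦ a ⟧ * (⟦ b ⟧ * (⟦ b ⟧ * x))    ≡⟨ cong (λ t → ⟦ a ⟧ * x - ⟦ a ⟧ * t) (⟦⟧-involutive b x) ⟩
  ⟦ a ⟧ * x - ⟦ a ⟧ * x                        ≡⟨ ℚₚ.+-inverseʳ (⟦ a ⟧ * x) ⟩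
  0ℚ                                           ∎
  where
  open ≡-Reasoning
  regroup : ∀ A B x → A * x + B * (- (A * B * x)) ≡ A * x - A * (B * (B * x))
  regroup = solve-∀ ℚ-ring

row : RawSigned n → Fin n → Vector ℚ n → ℚ
row A i x = ∑ λ j → entry (A i j) * x j

combination : Vector ℚ k → (Fin k → Vector ℚ n) → Vector ℚ n
combination c u j = ∑ λ l → c l * u l j

module _ (A : RawSigned n) where

  row-cong : ∀ i {x y} → x ≗ y → row A i x ≡ row A i y
  row-cong i x≗y = ∑-cong (λ j → cong (entry (A i j) *_) (x≗y j))

  row-zero : ∀ i → row A i (const 0ℚ) ≡ 0ℚ
  row-zero i = ∑-zero (λ j → ℚₚ.*-zeroʳ (entry (A i j)))

  row-combination : ∀ i (c : Vector ℚ k) u → row A i (combination c u) ≡ ∑ λ l → c l * row A i (u l)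
  row-combination i c u = begin
    ∑ (λ j → entry (A i j) * ∑ (λ l → c l * u l j))   ≡⟨ ∑-cong (λ j → ∑-*ˡ (entry (A i j)) (λ l → c l * u l j)) ⟩
    ∑ (λ j → ∑ (λ l → entry (A i j) * (c l * u l j))) ≡⟨ ∑-comm (λ j l → entry (A i j) * (c l * u l j)) ⟩
    ∑ (λ l → ∑ (λ j → entry (A i j) * (c l * u l j))) ≡⟨ ∑-cong (λ l → ∑-cong (λ j → swap (entry (A i j)) (c l) (u l j))) ⟩
    ∑ (λ l → ∑ (λ j → c l * (entry (A i j) * u l j))) ≡⟨ ∑-cong (λ l → ∑-*ˡ (c l) (λ j → entry (A i j) * u l j)) ⟨
    ∑ (λ l → c l * row A i (u l))                     ∎
    where
    open ≡-Reasoning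
    swap : ∀ a b x → a * (b * x) ≡ b * (a * x)
    swap = solve-∀ ℚ-ring

  combination-kernel : (c : Vector ℚ k) {u : Fin k → Vector ℚ n} →
                       (∀ l → InKernel A (u l)) → InKernel A (combination c u)
  combination-kernel c {u} u-kernel i = begin
    row A i (combination c u)       ≡⟨ row-combination i c u ⟩
    ∑ (λ l → c l * row A i (u l))   ≡⟨ ∑-zero (λ l → trans (cong (c l *_) (u-kernel l i)) (ℚₚ.*-zeroʳ (c l))) ⟩
    0ℚ                              ∎
    where open ≡-Reasoning

  row-two : ∀ {i a b} x → a ≢ b → (∀ j → j ≢ a → j ≢ b → A i j ≡ nothing) →
            row A i x ≡ entry (A i a) * x a + entry (A i b) * x b
  row-two {i} x a≢b A≡nothing =
    ∑-pair a≢b (λ j j≢a j≢b → trans (cong (λ e → entry e * x j) (A≡nothing j j≢a j≢b)) (ℚₚ.*-zeroˡ (x j)))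

isEdge-≢nothing : ∀ {e} → e ≢ nothing → isEdge e ≡ 1
isEdge-≢nothing {nothing} e≢nothing = contradiction refl e≢nothing
isEdge-≢nothing {just _}  _         = refl

module _ (Γ : SignedGraph n) {u a b : Fin n} (deg<3 : deg Γ u < 3) (a≢b : a ≢ b)
         (u~a : adj Γ u a ≢ nothing) (u~b : adj Γ u b ≢ nothing) where

  only-two-neighbours : ∀ j → j ≢ a → j ≢ b → adj Γ u j ≡ nothing
  only-two-neighbours j j≢a j≢b with adj Γ u j in u~j
  ... | nothing = refl
  ... | just _  = contradiction (subst (_≤ deg Γ u) three≡3 three≤deg) (ℕₚ.<⇒≱ deg<3)
    where
    three≤deg = three-terms≤∑ℕ (isEdge ∘ adj Γ u) a≢b (j≢a ∘ sym) (j≢b ∘ sym)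
    three≡3 : isEdge (adj Γ u a) ℕ.+ (isEdge (adj Γ u b) ℕ.+ isEdge (adj Γ u j)) ≡ 3
    three≡3 = cong₂ ℕ._+_ (isEdge-≢nothing u~a) (cong₂ ℕ._+_ (isEdge-≢nothing u~b) (cong isEdge u~j))

  row-of-degree-two : ∀ x → row (adj Γ) u x ≡ entry (adj Γ u a) * x a + entry (adj Γ u b) * x b
  row-of-degree-two x = row-two (adj Γ) x a≢b only-two-neighbours

record KernelIsomorphism (A : RawSigned n) (B : RawSigned m) : Set where
  field
    to            : Vector ℚ n → Vector ℚ m
    to-cong       : ∀ {x x′} → x ≗ x′ → to x ≗ to x′
    to-linear     : ∀ {k} (c : Vector ℚ k) u → to (combination c u) ≗ combination c (to ∘ u)
    to-kernel     : ∀ {x} → InKernel A x → InKernel B (to x)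
    to-injective  : ∀ {x} → InKernel A x → to x ≗ const 0ℚ → x ≗ const 0ℚ
    to-surjective : ∀ {y} → InKernel B y → ∃ λ x → InKernel A x × to x ≗ y

module _ {A : RawSigned n} {B : RawSigned m} (iso : KernelIsomorphism A B) where
  open KernelIsomorphism iso

  private
    to-zero : ∀ {x} → x ≗ const 0ℚ → to x ≗ const 0ℚ
    to-zero {x} x≗0 j = trans (to-cong x≗0 j) (to-linear {k = 0} (λ ()) (λ ()) j)

    image-independent : {u : Fin k → Vector ℚ n} → (∀ l → InKernel A (u l)) → LinIndep u → LinIndep (to ∘ u)
    image-independent {u = u} u-kernel u-indep c Σc·to-u≡0 = u-indep c λ j →
      to-injective (combination-kernel A c u-kernel) (λ j → trans (to-linear c u j) (Σc·to-u≡0 j)) j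

    module Preimages {y : Fin k → Vector ℚ m} (y-kernel : ∀ l → InKernel B (y l)) where

      x : Fin k → Vector ℚ n
      x l = proj₁ (to-surjective (y-kernel l))

      x-kernel : ∀ l → InKernel A (x l)
      x-kernel l = proj₁ (proj₂ (to-surjective (y-kernel l)))

      x-independent : LinIndep y → LinIndep x
      x-independent y-indep c Σc·x≡0 = y-indep c λ j → begin
        combination c y j           ≡⟨ ∑-cong (λ l → cong (c l *_) (proj₂ (proj₂ (to-surjective (y-kernel l))) j)) ⟨
        combination c (to ∘ x) j    ≡⟨ to-linear c x j ⟨
        to (combination c x) j      ≡⟨ to-zero Σc·x≡0 j ⟩
        0ℚ                          ∎
        where open ≡-Reasoning

  sameNullity : SameNullity A B
  sameNullity k = transfer , reflect
    where
    transfer : IsNullity A k → IsNullity B k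
    transfer ((u , u-kernel , u-indep) , maximal) =
      (to ∘ u , to-kernel ∘ u-kernel , image-independent u-kernel u-indep) ,
      λ y y-kernel y-indep → let open Preimages y-kernel in maximal x x-kernel (x-independent y-indep)

    reflect : IsNullity B k → IsNullity A k
    reflect ((y , y-kernel , y-indep) , maximal) =
      (x , x-kernel , x-independent y-indep) ,
      λ u u-kernel u-indep → maximal (to ∘ u) (to-kernel ∘ u-kernel) (image-independent u-kernel u-indep)
      where open Preimages y-kernel

module _ {K : ℕ} where
  open import Function.Endo.Propositional (Fin (suc K)) using (_^_; ^-homo)

  private
    %-suc : ∀ a → suc (a % suc K) % suc K ≡ suc a % suc K
    %-suc a = trans (%-distribˡ-+ 1 (a % suc K) (suc K))
      (trans (cong (λ t → (1 % suc K ℕ.+ t) % suc K) (m%n%n≡m%n a (suc K))) (sym (%-distribˡ-+ 1 a (suc K))))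

    %-self : ∀ (i : Fin (suc K)) → (toℕ i ℕ.+ suc K) % suc K ≡ toℕ i
    %-self i = trans ([m+n]%n≡m%n (toℕ i) (suc K)) (m<n⇒m%n≡m (Finₚ.toℕ<n i))

  toℕ-walk : ∀ r (i : Fin (suc K)) → toℕ ((next ^ r) i) ≡ (toℕ i ℕ.+ r) % suc K
  toℕ-walk zero    i = sym (trans (cong (_% suc K) (ℕₚ.+-identityʳ (toℕ i))) (m<n⇒m%n≡m (Finₚ.toℕ<n i)))
  toℕ-walk (suc r) i = begin
    toℕ (next ((next ^ r) i))            ≡⟨ Finₚ.toℕ-fromℕ< _ ⟩
    suc (toℕ ((next ^ r) i)) % suc K     ≡⟨ cong (λ t → suc t % suc K) (toℕ-walk r i) ⟩
    suc ((toℕ i ℕ.+ r) % suc K) % suc K  ≡⟨ %-suc (toℕ i ℕ.+ r) ⟩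
    suc (toℕ i ℕ.+ r) % suc K            ≡⟨ cong (_% suc K) (ℕₚ.+-suc (toℕ i) r) ⟨
    (toℕ i ℕ.+ suc r) % suc K            ∎
    where open ≡-Reasoning

  walk-period : ∀ i → (next ^ suc K) i ≡ i
  walk-period i = Finₚ.toℕ-injective (trans (toℕ-walk (suc K) i) (%-self i))

  walk-reaches : ∀ i j → ∃ λ r → (next ^ r) i ≡ j
  walk-reaches i j = r , Finₚ.toℕ-injective (begin
    toℕ ((next ^ r) i)                               ≡⟨ toℕ-walk r i ⟩
    (toℕ i ℕ.+ (toℕ j ℕ.+ (suc K ∸ toℕ i))) % suc K  ≡⟨ cong (_% suc K) rearrange ⟩
    (toℕ j ℕ.+ suc K) % suc K                        ≡⟨ %-self j ⟩
    toℕ j                                            ∎)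
    where
    open ≡-Reasoning
    r = toℕ j ℕ.+ (suc K ∸ toℕ i)
    rearrange : toℕ i ℕ.+ (toℕ j ℕ.+ (suc K ∸ toℕ i)) ≡ toℕ j ℕ.+ suc K
    rearrange = trans (sym (ℕₚ.+-assoc (toℕ i) (toℕ j) _))
      (trans (cong (ℕ._+ (suc K ∸ toℕ i)) (ℕₚ.+-comm (toℕ i) (toℕ j)))
        (trans (ℕₚ.+-assoc (toℕ j) (toℕ i) _) (cong (toℕ j ℕ.+_) (ℕₚ.m+[n∸m]≡n (ℕₚ.<⇒≤ (Finₚ.toℕ<n i))))))

  walk-moves : ∀ {r} i → 0 < r → r < suc K → (next ^ r) i ≢ i
  walk-moves {r} i 0<r r<T walk≡i = r≢multiple ((toℕ i ℕ.+ r) / suc K) (ℕₚ.+-cancelˡ-≡ (toℕ i) r _ i+r≡i+qT)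
    where
    i+r≡i+qT : toℕ i ℕ.+ r ≡ toℕ i ℕ.+ (toℕ i ℕ.+ r) / suc K ℕ.* suc K
    i+r≡i+qT = trans (m≡m%n+[m/n]*n (toℕ i ℕ.+ r) (suc K))
      (cong (ℕ._+ (toℕ i ℕ.+ r) / suc K ℕ.* suc K) (trans (sym (toℕ-walk r i)) (cong toℕ walk≡i)))
    r≢multiple : ∀ q → r ≢ q ℕ.* suc K
    r≢multiple zero    r≡0  = ℕₚ.<-irrefl (sym r≡0) 0<r
    r≢multiple (suc q) r≡qT = ℕₚ.<⇒≱ r<T (subst (suc K ≤_) (sym r≡qT) (ℕₚ.m≤m+n (suc K) (q ℕ.* suc K)))

  prev : Fin (suc K) → Fin (suc K)
  prev = next ^ K

  next-prev : ∀ i → next (prev i) ≡ i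
  next-prev = walk-period

  prev-next : ∀ i → prev (next i) ≡ i
  prev-next i = begin
    (next ^ K) (next i)      ≡⟨ cong (λ f → f i) (^-homo next K 1) ⟨
    (next ^ (K ℕ.+ 1)) i     ≡⟨ cong (λ r → (next ^ r) i) (ℕₚ.+-comm K 1) ⟩
    (next ^ suc K) i         ≡⟨ walk-period i ⟩
    i                        ∎
    where open ≡-Reasoning

module _ {k : ℕ} where

  next≢id : (i : Fin (3 ℕ.+ k)) → next i ≢ i
  next≢id i = walk-moves {r = 1} i (s≤s z≤n) (s≤s (s≤s z≤n))

  next²≢id : (i : Fin (3 ℕ.+ k)) → next (next i) ≢ i
  next²≢id i = walk-moves {r = 2} i (s≤s z≤n) (s≤s (s≤s (s≤s z≤n)))

  next≢prev : (i : Fin (3 ℕ.+ k)) → next i ≢ prev i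
  next≢prev i eq = next²≢id i (trans (cong next eq) (next-prev i))

  prev≢id : (i : Fin (3 ℕ.+ k)) → prev i ≢ i
  prev≢id i eq = next≢id i (trans (cong next (sym eq)) (next-prev i))

  module _ (e : Fin (3 ℕ.+ k) → Maybe Sign) where

    cycleAdj-next : ∀ i → cycleAdj e i (next i) ≡ e i
    cycleAdj-next i with next i Finₚ.≟ next i
    ... | yes _    = refl
    ... | no ≢next = contradiction refl ≢next

    cycleAdj-prev : ∀ i → cycleAdj e i (prev i) ≡ e (prev i)
    cycleAdj-prev i with prev i Finₚ.≟ next i
    ... | yes prev≡next = contradiction (sym prev≡next) (next≢prev i)
    ... | no _ with i Finₚ.≟ next (prev i)
    ...   | yes _    = refl
    ...   | no ≢next = contradiction (sym (next-prev i)) ≢next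

    cycleAdj-other : ∀ i j → j ≢ next i → j ≢ prev i → cycleAdj e i j ≡ nothing
    cycleAdj-other i j j≢next j≢prev with j Finₚ.≟ next i
    ... | yes j≡next = contradiction j≡next j≢next
    ... | no _ with i Finₚ.≟ next j
    ...   | yes i≡next = contradiction (trans (sym (prev-next j)) (cong prev (sym i≡next))) j≢prev
    ...   | no _       = refl

    cycle-row : ∀ i z → row (cycleAdj e) i z ≡ entry (e i) * z (next i) + entry (e (prev i)) * z (prev i)
    cycle-row i z = trans (row-two (cycleAdj e) z (next≢prev i) (cycleAdj-other i))
      (cong₂ (λ s t → entry s * z (next i) + entry t * z (prev i)) (cycleAdj-next i) (cycleAdj-prev i))

    cycle-row-next : ∀ i z → row (cycleAdj e) (next i) z ≡ entry (e (next i)) * z (next (next i)) + entry (e i) * z i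
    cycle-row-next i z = trans (cycle-row (next i) z)
      (cong (λ j → entry (e (next i)) * z (next (next i)) + entry (e j) * z j) (prev-next i))

    cycle-unique : (∀ i → e i ≢ nothing) → ∀ p {z z′} →
                   (∀ i → i ≢ p → row (cycleAdj e) i z ≡ 0ℚ) → (∀ i → i ≢ p → row (cycleAdj e) i z′ ≡ 0ℚ) →
                   z p ≡ z′ p → z (next p) ≡ z′ (next p) → z ≗ z′
    cycle-unique e≢nothing p {z} {z′} z-rows z′-rows zp≡ znp≡ j =
      let r , walk≡j = walk-reaches p j in proj₁ (subst Agree walk≡j (along r))
      where
      open import Function.Endo.Propositional (Fin (3 ℕ.+ k)) using (_^_)

      Agree : Fin (3 ℕ.+ k) → Set
      Agree i = z i ≡ z′ i × z (next i) ≡ z′ (next i)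

      step : ∀ i → Agree i → Agree (next i)
      step i (zi≡ , zni≡) with next i Finₚ.≟ p
      ... | yes next≡p = zni≡ , subst (λ l → z (next l) ≡ z′ (next l)) (sym next≡p) znp≡
      ... | no  next≢p = zni≡ , entry-cancelˡ (e≢nothing (next i)) (begin
        entry (e (next i)) * z (next (next i))   ≡⟨ inverseˡ-unique _ _ (trans (sym (cycle-row-next i z)) (z-rows (next i) next≢p)) ⟩
        - (entry (e i) * z i)                    ≡⟨ cong (λ t → - (entry (e i) * t)) zi≡ ⟩
        - (entry (e i) * z′ i)                   ≡⟨ inverseˡ-unique _ _ (trans (sym (cycle-row-next i z′)) (z′-rows (next i) next≢p)) ⟨
        entry (e (next i)) * z′ (next (next i))  ∎)
        where open ≡-Reasoning

      along : ∀ r → Agree ((next ^ r) p)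
      along zero    = zp≡ , znp≡
      along (suc r) = step _ (along r)

module NullityTwoCycle {k} (e : Fin (3 ℕ.+ k) → Maybe Sign) (e≢nothing : ∀ i → e i ≢ nothing)
                       (nullity : IsNullity (cycleAdj e) 2) (p : Fin (3 ℕ.+ k)) where

  private
    C = cycleAdj e
    q = next p
    basis = proj₁ (proj₁ nullity)
    a = basis zero
    b = basis (suc zero)

    independent-at-p-next : ∀ α β → α * a p + β * b p ≡ 0ℚ → α * a q + β * b q ≡ 0ℚ → α ≡ 0ℚ × β ≡ 0ℚ
    independent-at-p-next α β at-p at-q = independent zero , independent (suc zero)
      where
      c = α ∷ β ∷ []
      at : ∀ i → α * a i + β * b i ≡ 0ℚ → combination c basis i ≡ 0ℚ
      at i eq = trans (cong (α * a i +_) (ℚₚ.+-identityʳ (β * b i))) eq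
      vanishes : combination c basis ≗ const 0ℚ
      vanishes = cycle-unique e e≢nothing p (λ i _ → combination-kernel C c {basis} (proj₁ (proj₂ (proj₁ nullity))) i)
        (λ i _ → row-zero C i) (at p at-p) (at q at-q)
      independent = proj₂ (proj₂ (proj₁ nullity)) c vanishes

    det : ℚ
    det = a p * b q - a q * b p

    -- if det = 0, the dependencies (b q, - a q) and (b p, - a p) make a and b vanish at p and q,
    -- and then (1, 0) is a dependency too
    det≢0 : det ≢ 0ℚ
    det≢0 det≡0 = 1≢0 (proj₁ (independent-at-p-next 1ℚ 0ℚ (vanish ap≡0 bp≡0) (vanish aq≡0 bq≡0)))
      where
      1≢0 : 1ℚ ≢ 0ℚ
      1≢0 ()
      vanish : ∀ {s t} → s ≡ 0ℚ → t ≡ 0ℚ → 1ℚ * s + 0ℚ * t ≡ 0ℚ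
      vanish refl refl = refl
      cross : ∀ x y → y * x + (- x) * y ≡ 0ℚ
      cross = solve-∀ ℚ-ring
      det-at-p : ∀ ap aq bp bq → bq * ap + (- aq) * bp ≡ ap * bq - aq * bp
      det-at-p = solve-∀ ℚ-ring
      det-at-q : ∀ ap aq bp bq → bp * aq + (- ap) * bq ≡ - (ap * bq - aq * bp)
      det-at-q = solve-∀ ℚ-ring
      at-q = independent-at-p-next (b q) (- a q) (trans (det-at-p (a p) (a q) (b p) (b q)) det≡0) (cross (a q) (b q))
      at-p = independent-at-p-next (b p) (- a p) (cross (a p) (b p)) (trans (det-at-q (a p) (a q) (b p) (b q)) (cong -_ det≡0))
      bq≡0 = proj₁ at-q
      aq≡0 = ℚₚ.neg-injective (proj₂ at-q)
      bp≡0 = proj₁ at-p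
      ap≡0 = ℚₚ.neg-injective (proj₂ at-p)

  private
    instance
      det-nonZero = ≢-nonZero det≢0

    coefficients : ℚ → ℚ → Vector ℚ 2
    coefficients α β = ((α * b q - β * b p) * 1/ det) ∷ ((β * a p - α * a q) * 1/ det) ∷ []

  -- Cramer's rule for the values α at p and β at next p in the basis a, b
  extension : ℚ → ℚ → Vector ℚ (3 ℕ.+ k)
  extension α β = combination (coefficients α β) basis

  extension-kernel : ∀ α β → InKernel C (extension α β)
  extension-kernel α β = combination-kernel C (coefficients α β) {basis} (proj₁ (proj₂ (proj₁ nullity)))

  private
    cramer : ∀ x y u v d → (x * d) * u + ((y * d) * v + 0ℚ) ≡ (x * u + y * v) * d
    cramer = solve-∀ ℚ-ring

    det-p : ∀ α β ap aq bp bq → (α * bq - β * bp) * ap + (β * ap - α * aq) * bp ≡ α * (ap * bq - aq * bp)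
    det-p = solve-∀ ℚ-ring

    det-q : ∀ α β ap aq bp bq → (α * bq - β * bp) * aq + (β * ap - α * aq) * bq ≡ β * (ap * bq - aq * bp)
    det-q = solve-∀ ℚ-ring

    cancel-det : ∀ γ → γ * det * 1/ det ≡ γ
    cancel-det γ = trans (ℚₚ.*-assoc γ det (1/ det)) (trans (cong (γ *_) (ℚₚ.*-inverseʳ det)) (ℚₚ.*-identityʳ γ))

  extension-at-p : ∀ α β → extension α β p ≡ α
  extension-at-p α β = trans (cramer (α * b q - β * b p) (β * a p - α * a q) (a p) (b p) (1/ det))
    (trans (cong (_* 1/ det) (det-p α β (a p) (a q) (b p) (b q))) (cancel-det α))

  extension-at-next : ∀ α β → extension α β (next p) ≡ β
  extension-at-next α β = trans (cramer (α * b q - β * b p) (β * a p - α * a q) (a q) (b q) (1/ det))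
    (trans (cong (_* 1/ det) (det-q α β (a p) (a q) (b p) (b q))) (cancel-det β))

  extension-unique : ∀ {z} → (∀ i → i ≢ p → row C i z ≡ 0ℚ) → z ≗ extension (z p) (z (next p))
  extension-unique {z} z-rows = cycle-unique e e≢nothing p z-rows (λ i _ → extension-kernel (z p) (z q) i)
    (sym (extension-at-p (z p) (z q))) (sym (extension-at-next (z p) (z q)))

  kernel-closure : ∀ {z} → (∀ i → i ≢ p → row C i z ≡ 0ℚ) → InKernel C z
  kernel-closure {z} z-rows i = trans (row-cong C i {z} (extension-unique z-rows)) (extension-kernel (z p) (z q) i)

  extension-linear : ∀ {l} (c α β : Vector ℚ l) →
                     extension (∑ λ j → c j * α j) (∑ λ j → c j * β j) ≗ combination c (λ j → extension (α j) (β j))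
  extension-linear c α β i = sym (trans (extension-unique {combination c ext} (λ i _ → combination-kernel C c {ext} ext-kernel i) i)
    (cong₂ (λ s t → extension s t i)
      (∑-cong (λ j → cong (c j *_) (extension-at-p (α j) (β j))))
      (∑-cong (λ j → cong (c j *_) (extension-at-next (α j) (β j))))))
    where
    ext = λ j → extension (α j) (β j)
    ext-kernel = λ j → extension-kernel (α j) (β j)

private
  when-yes : ∀ {P : Set} (d : Dec P) x → P → (if does d then x else 0ℚ) ≡ x
  when-yes d x p = cong (if_then x else 0ℚ) (dec-true d p)

  when-no : ∀ {P : Set} (d : Dec P) x → ¬ P → (if does d then x else 0ℚ) ≡ 0ℚ
  when-no d x ¬p = cong (if_then x else 0ℚ) (dec-false d ¬p)

module _ {B : Set} (_≟_ : DecidableEquality B) where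

  push : (Fin m → B) → Vector ℚ m → B → ℚ
  push h y b = ∑ λ j → if does (h j ≟ b) then y j else 0ℚ

  push-image : {h : Fin m → B} → Injective _≡_ _≡_ h → ∀ y j → push h y (h j) ≡ y j
  push-image {h = h} h-inj y j = trans (∑-single j (λ l l≢j → when-no (h l ≟ h j) (y l) (l≢j ∘ h-inj)))
                                      (when-yes (h j ≟ h j) (y j) refl)

  push-outside : ∀ (h : Fin m → B) y {b} → (∀ j → h j ≢ b) → push h y b ≡ 0ℚ
  push-outside h y {b} ∉image = ∑-zero (λ j → when-no (h j ≟ b) (y j) (∉image j))

  extend : (Fin m → B) → Vector ℚ m → (B → ℚ) → B → ℚ
  extend h y d b with Finₚ.any? (λ j → h j ≟ b)
  ... | yes (j , _) = y j
  ... | no _        = d b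

  extend-image : {h : Fin m → B} → Injective _≡_ _≡_ h → ∀ y d j → extend h y d (h j) ≡ y j
  extend-image {h = h} h-inj y d j with Finₚ.any? (λ l → h l ≟ h j)
  ... | yes (l , hl≡hj) = cong y (h-inj hl≡hj)
  ... | no ∉image       = contradiction (j , refl) ∉image

  extend-outside : ∀ (h : Fin m → B) y d {b} → (∀ j → h j ≢ b) → extend h y d b ≡ d b
  extend-outside h y d {b} ∉image with Finₚ.any? (λ l → h l ≟ b)
  ... | yes (l , hl≡b) = contradiction hl≡b (∉image l)
  ... | no _           = refl

∑-push : (h : Fin m → Fin n) (y : Vector ℚ m) → ∑ (push Finₚ._≟_ h y) ≡ ∑ y
∑-push h y = trans (∑-comm (λ b j → if does (h j Finₚ.≟ b) then y j else 0ℚ))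
  (∑-cong λ j → trans (∑-single (h j) (λ b b≢hj → when-no (h j Finₚ.≟ b) (y j) (b≢hj ∘ sym)))
                      (when-yes (h j Finₚ.≟ h j) (y j) refl))

_≟⊎_ : ∀ {p} → DecidableEquality (Fin n ⊎ Fin p)
_≟⊎_ = ⊎ₚ.≡-dec Finₚ._≟_ Finₚ._≟_

∑-push-⊎ : ∀ {p} (h : Fin m → Fin n ⊎ Fin p) (y : Vector ℚ m) →
           ∑ (push _≟⊎_ h y ∘ inj₁) + ∑ (push _≟⊎_ h y ∘ inj₂) ≡ ∑ y
∑-push-⊎ h y = begin
  ∑ (λ u → ∑ (λ j → t j (inj₁ u))) + ∑ (λ q → ∑ (λ j → t j (inj₂ q)))
    ≡⟨ cong₂ _+_ (∑-comm (λ u j → t j (inj₁ u))) (∑-comm (λ q j → t j (inj₂ q))) ⟩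
  ∑ (λ j → ∑ (λ u → t j (inj₁ u))) + ∑ (λ j → ∑ (λ q → t j (inj₂ q)))
    ≡⟨ ∑-+ (λ j → ∑ (λ u → t j (inj₁ u))) (λ j → ∑ (λ q → t j (inj₂ q))) ⟨
  ∑ (λ j → ∑ (λ u → t j (inj₁ u)) + ∑ (λ q → t j (inj₂ q)))
    ≡⟨ ∑-cong (λ j → split j (h j) refl) ⟩
  ∑ y ∎
  where
  open ≡-Reasoning
  t : _ → _ → ℚ
  t j b = if does (h j ≟⊎ b) then y j else 0ℚ
  split : ∀ j b → h j ≡ b → ∑ (λ u → t j (inj₁ u)) + ∑ (λ q → t j (inj₂ q)) ≡ y j
  split j (inj₁ u₀) hj≡ = trans (cong₂ _+_
    (trans (∑-single u₀ λ u u≢u₀ → when-no (h j ≟⊎ inj₁ u) (y j) (u≢u₀ ∘ sym ∘ ⊎ₚ.inj₁-injective ∘ trans (sym hj≡)))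
           (when-yes (h j ≟⊎ inj₁ u₀) (y j) hj≡))
    (∑-zero (λ q → when-no (h j ≟⊎ inj₂ q) (y j) (λ hj≡q → contradiction (trans (sym hj≡) hj≡q) λ ()))))
    (ℚₚ.+-identityʳ (y j))
  split j (inj₂ q₀) hj≡ = trans (cong₂ _+_
    (∑-zero (λ u → when-no (h j ≟⊎ inj₁ u) (y j) (λ hj≡u → contradiction (trans (sym hj≡u) hj≡) λ ())))
    (trans (∑-single q₀ λ q q≢q₀ → when-no (h j ≟⊎ inj₂ q) (y j) (q≢q₀ ∘ sym ∘ ⊎ₚ.inj₂-injective ∘ trans (sym hj≡)))
           (when-yes (h j ≟⊎ inj₂ q₀) (y j) hj≡)))
    (ℚₚ.+-identityˡ (y j))

-- z i is the value at the i-th vertex of the path, equation l is the row of the inner vertex suc (inject₁ l)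
PathEquations : (Fin 5 → Sign) → Vector ℚ 6 → Set
PathEquations s z = ∀ (l : Fin 4) → ⟦ s (inject₁ l) ⟧ * z (inject₁ (inject₁ l)) + ⟦ s (suc l) ⟧ * z (suc (suc l)) ≡ 0ℚ

pathSign : (Fin 5 → Sign) → Sign
pathSign s = s 0F · (s 1F · (s 2F · (s 3F · s 4F)))

module _ (s : Fin 5 → Sign) where

  -- the values at even positions are propagated from α, those at odd positions from β
  pathValues : ℚ → ℚ → Vector ℚ 6
  pathValues α β 0F = α
  pathValues α β 1F = - (⟦ s 2F ⟧ * ⟦ s 1F ⟧ * pathValues α β 3F)
  pathValues α β 2F = - (⟦ s 0F ⟧ * ⟦ s 1F ⟧ * α)
  pathValues α β 3F = - (⟦ s 4F ⟧ * ⟦ s 3F ⟧ * β)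
  pathValues α β 4F = - (⟦ s 2F ⟧ * ⟦ s 3F ⟧ * pathValues α β 2F)
  pathValues α β 5F = β

  pathValues-equations : ∀ α β → PathEquations s (pathValues α β)
  pathValues-equations α β 0F = sign-solution (s 0F) (s 1F) α
  pathValues-equations α β 1F = trans (ℚₚ.+-comm (⟦ s 1F ⟧ * pathValues α β 1F) (⟦ s 2F ⟧ * pathValues α β 3F))
                                      (sign-solution (s 2F) (s 1F) (pathValues α β 3F))
  pathValues-equations α β 2F = sign-solution (s 2F) (s 3F) (pathValues α β 2F)
  pathValues-equations α β 3F = trans (ℚₚ.+-comm (⟦ s 3F ⟧ * pathValues α β 3F) (⟦ s 4F ⟧ * β)) (sign-solution (s 4F) (s 3F) β)

  module _ {z : Vector ℚ 6} (eqs : PathEquations s z) where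

    path-unique : z ≗ pathValues (z 0F) (z 5F)
    path-unique 0F = refl
    path-unique 1F = trans (sign-solve (s 2F) (s 1F) (trans (ℚₚ.+-comm (⟦ s 2F ⟧ * z 3F) (⟦ s 1F ⟧ * z 1F)) (eqs 1F)))
                           (cong (λ t → - (⟦ s 2F ⟧ * ⟦ s 1F ⟧ * t)) (path-unique 3F))
    path-unique 2F = sign-solve (s 0F) (s 1F) (eqs 0F)
    path-unique 3F = sign-solve (s 4F) (s 3F) (trans (ℚₚ.+-comm (⟦ s 4F ⟧ * z 5F) (⟦ s 3F ⟧ * z 3F)) (eqs 3F))
    path-unique 4F = trans (sign-solve (s 2F) (s 3F) (eqs 2F))
                           (cong (λ t → - (⟦ s 2F ⟧ * ⟦ s 3F ⟧ * t)) (path-unique 2F))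
    path-unique 5F = refl

    path-vanishes : z 0F ≡ 0ℚ → z 5F ≡ 0ℚ → z ≗ const 0ℚ
    path-vanishes z0≡0 z5≡0 i = trans (path-unique i) (trans (cong₂ (λ α β → pathValues α β i) z0≡0 z5≡0) (zero-values i))
      where
      neg-zero : ∀ x → - (x * 0ℚ) ≡ 0ℚ
      neg-zero x = cong -_ (ℚₚ.*-zeroʳ x)
      zero-values : pathValues 0ℚ 0ℚ ≗ const 0ℚ
      zero-values 0F = refl
      zero-values 1F = trans (cong (λ t → - (⟦ s 2F ⟧ * ⟦ s 1F ⟧ * t)) (zero-values 3F)) (neg-zero (⟦ s 2F ⟧ * ⟦ s 1F ⟧))
      zero-values 2F = neg-zero (⟦ s 0F ⟧ * ⟦ s 1F ⟧)
      zero-values 3F = neg-zero (⟦ s 4F ⟧ * ⟦ s 3F ⟧)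
      zero-values 4F = trans (cong (λ t → - (⟦ s 2F ⟧ * ⟦ s 3F ⟧ * t)) (zero-values 2F)) (neg-zero (⟦ s 2F ⟧ * ⟦ s 3F ⟧))
      zero-values 5F = refl

    private
      ⟦pathSign⟧ : ⟦ pathSign s ⟧ ≡ ⟦ s 0F ⟧ * (⟦ s 1F ⟧ * (⟦ s 2F ⟧ * (⟦ s 3F ⟧ * ⟦ s 4F ⟧)))
      ⟦pathSign⟧ = trans (⟦·⟧ (s 0F) _) (cong (⟦ s 0F ⟧ *_) (trans (⟦·⟧ (s 1F) _)
                     (cong (⟦ s 1F ⟧ *_) (trans (⟦·⟧ (s 2F) _) (cong (⟦ s 2F ⟧ *_) (⟦·⟧ (s 3F) (s 4F)))))))

      from-end₅ : ∀ a b c d e x → a * (- (c * b * (- (e * d * x)))) ≡ a * (b * (c * (d * e))) * x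
      from-end₅ = solve-∀ ℚ-ring

      from-end₀ : ∀ a b c d e x → e * (- (c * d * (- (a * b * x)))) ≡ a * (b * (c * (d * e))) * x
      from-end₀ = solve-∀ ℚ-ring

    path-end₀ : ⟦ s 0F ⟧ * z 1F ≡ ⟦ pathSign s ⟧ * z 5F
    path-end₀ = trans (cong (⟦ s 0F ⟧ *_) (path-unique 1F))
      (trans (from-end₅ ⟦ s 0F ⟧ ⟦ s 1F ⟧ ⟦ s 2F ⟧ ⟦ s 3F ⟧ ⟦ s 4F ⟧ (z 5F)) (cong (_* z 5F) (sym ⟦pathSign⟧)))

    path-end₅ : ⟦ s 4F ⟧ * z 4F ≡ ⟦ pathSign s ⟧ * z 0F
    path-end₅ = trans (cong (⟦ s 4F ⟧ *_) (path-unique 4F))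
      (trans (from-end₀ ⟦ s 0F ⟧ ⟦ s 1F ⟧ ⟦ s 2F ⟧ ⟦ s 3F ⟧ ⟦ s 4F ⟧ (z 0F)) (cong (_* z 0F) (sym ⟦pathSign⟧)))

Inner : (Fin 6 → Fin n) → Fin n → Set
Inner v x = ∃ λ (l : Fin 4) → x ≡ v (suc (inject₁ l))

module PathContraction
  (Γ : SignedGraph n) (v : Fin 6 → Fin n) (v-inj : Injective _≡_ _≡_ v) (s : Fin 5 → Sign)
  (path-edge : ∀ (i : Fin 5) → adj Γ (v (inject₁ i)) (v (suc i)) ≡ just (s i))
  (inner-degree : ∀ (l : Fin 4) → deg Γ (v (suc (inject₁ l))) ≡ 2)
  (ends-apart : adj Γ (v 0F) (v 5F) ≡ nothing)
  (Γ′ : SignedGraph m) (f : Fin m → Fin n) (f-inj : Injective _≡_ _≡_ f)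
  (f-avoids-inner : ∀ i → ¬ Inner v (f i))
  (f-covers : ∀ x → ¬ Inner v x → ∃ λ i → f i ≡ x)
  (new-edge : ∀ i j → f i ≡ v 0F → f j ≡ v 5F → adj Γ′ i j ≡ just (pathSign s))
  (old-edges : ∀ i j → ¬ (f i ≡ v 0F × f j ≡ v 5F) → ¬ (f i ≡ v 5F × f j ≡ v 0F) → adj Γ′ i j ≡ adj Γ (f i) (f j))
  where

  private
    σ = pathSign s

    inner? : ∀ u → Dec (Inner v u)
    inner? u = Finₚ.any? (λ l → u Finₚ.≟ v (suc (inject₁ l)))

    just≢nothing : ∀ {t : Sign} {e} → e ≡ just t → e ≢ nothing
    just≢nothing refl ()

    module InnerVertex (l : Fin 4) where
      vertex = v (suc (inject₁ l))
      left   = v (inject₁ (inject₁ l))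
      right  = v (suc (suc l))

      left-edge : adj Γ vertex left ≡ just (s (inject₁ l))
      left-edge = trans (adj-sym Γ vertex left) (path-edge (inject₁ l))

      right-edge : adj Γ vertex right ≡ just (s (suc l))
      right-edge = path-edge (suc l)

      left≢right : left ≢ right
      left≢right = apart l ∘ v-inj
        where
        apart : ∀ (l : Fin 4) → inject₁ (inject₁ l) ≢ suc (suc l)
        apart 0F ()
        apart 1F ()
        apart 2F ()
        apart 3F ()

      degree<3 : deg Γ vertex < 3
      degree<3 = subst (_< 3) (sym (inner-degree l)) (ℕₚ.n<1+n 2)

      row-inner : ∀ x → row (adj Γ) vertex x ≡ ⟦ s (inject₁ l) ⟧ * x left + ⟦ s (suc l) ⟧ * x right
      row-inner x = trans (row-of-degree-two Γ degree<3 left≢right (just≢nothing left-edge) (just≢nothing right-edge) x)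
        (cong₂ (λ a b → entry a * x left + entry b * x right) left-edge right-edge)

      isolated : ∀ {u} → u ≢ left → u ≢ right → adj Γ u vertex ≡ nothing
      isolated {u} u≢left u≢right = trans (adj-sym Γ u vertex)
        (only-two-neighbours Γ degree<3 left≢right (just≢nothing left-edge) (just≢nothing right-edge) u u≢left u≢right)

  kernel⇒path : ∀ {x} → InKernel (adj Γ) x → PathEquations s (x ∘ v)
  kernel⇒path {x} x-kernel l = trans (sym (InnerVertex.row-inner l x)) (x-kernel (InnerVertex.vertex l))

  path⇒inner-rows : ∀ {x} → PathEquations s (x ∘ v) → ∀ l → row (adj Γ) (v (suc (inject₁ l))) x ≡ 0ℚ
  path⇒inner-rows {x} eqs l = trans (InnerVertex.row-inner l x) (eqs l)

  private
    v-distinct : ∀ {a b} → a ≢ b → v a ≢ v b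
    v-distinct a≢b = a≢b ∘ v-inj

    first-outer : ¬ Inner v (v 0F)
    first-outer (l , eq) with v-inj eq
    ... | ()

    last-outer : ¬ Inner v (v 5F)
    last-outer (l , eq) = apart l (v-inj eq)
      where
      apart : ∀ (l : Fin 4) → 5F ≢ suc (inject₁ l)
      apart 0F ()
      apart 1F ()
      apart 2F ()
      apart 3F ()

    first-isolated : ∀ {u} → Inner v u → u ≢ v 1F → adj Γ (v 0F) u ≡ nothing
    first-isolated (0F , refl) u≢v₁ = contradiction refl u≢v₁
    first-isolated (1F , refl) _    = InnerVertex.isolated 1F (v-distinct λ ()) (v-distinct λ ())
    first-isolated (2F , refl) _    = InnerVertex.isolated 2F (v-distinct λ ()) (v-distinct λ ())
    first-isolated (3F , refl) _    = InnerVertex.isolated 3F (v-distinct λ ()) (v-distinct λ ())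

    last-isolated : ∀ {u} → Inner v u → u ≢ v 4F → adj Γ (v 5F) u ≡ nothing
    last-isolated (0F , refl) _    = InnerVertex.isolated 0F (v-distinct λ ()) (v-distinct λ ())
    last-isolated (1F , refl) _    = InnerVertex.isolated 1F (v-distinct λ ()) (v-distinct λ ())
    last-isolated (2F , refl) _    = InnerVertex.isolated 2F (v-distinct λ ()) (v-distinct λ ())
    last-isolated (3F , refl) u≢v₄ = contradiction refl u≢v₄

    first-preimage = f-covers (v 0F) first-outer
    last-preimage  = f-covers (v 5F) last-outer

    module Compare {x : Vector ℚ n} {y : Vector ℚ m} (agree : x ∘ f ≗ y) (i : Fin m) where

      F : Vector ℚ n
      F u = entry (adj Γ (f i) u) * x u

      G : Vector ℚ n
      G = push Finₚ._≟_ f (λ j → entry (adj Γ′ i j) * y j)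

      ∑G : ∑ G ≡ row (adj Γ′) i y
      ∑G = ∑-push f (λ j → entry (adj Γ′ i j) * y j)

      G-image : ∀ j → G (f j) ≡ entry (adj Γ′ i j) * x (f j)
      G-image j = trans (push-image Finₚ._≟_ f-inj _ j) (cong (entry (adj Γ′ i j) *_) (sym (agree j)))

      G-inner : ∀ {u} → Inner v u → G u ≡ 0ℚ
      G-inner u-inner = push-outside Finₚ._≟_ f _ (λ j fj≡u → f-avoids-inner j (subst (Inner v) (sym fj≡u) u-inner))

      F≡G-old : ∀ j → adj Γ′ i j ≡ adj Γ (f i) (f j) → F (f j) ≡ G (f j)
      F≡G-old j old = trans (cong (λ e → entry e * x (f j)) (sym old)) (sym (G-image j))

      F≡G-inner : ∀ {u} → Inner v u → adj Γ (f i) u ≡ nothing → F u ≡ G u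
      F≡G-inner {u} u-inner fi≁u = trans (cong (λ e → entry e * x u) fi≁u) (trans (ℚₚ.*-zeroˡ (x u)) (sym (G-inner u-inner)))

    kept-row : ∀ {x y} → x ∘ f ≗ y → ∀ i → f i ≢ v 0F → f i ≢ v 5F → row (adj Γ) (f i) x ≡ row (adj Γ′) i y
    kept-row {x} {y} agree i fi≢v₀ fi≢v₅ = trans (∑-cong F≡G) ∑G
      where
      open Compare {x} {y} agree i
      off-path : ∀ k → f i ≢ v k
      off-path 0F = fi≢v₀
      off-path 1F = λ eq → f-avoids-inner i (0F , eq)
      off-path 2F = λ eq → f-avoids-inner i (1F , eq)
      off-path 3F = λ eq → f-avoids-inner i (2F , eq)
      off-path 4F = λ eq → f-avoids-inner i (3F , eq)
      off-path 5F = fi≢v₅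
      F≡G : F ≗ G
      F≡G u with inner? u
      ... | yes u-inner@(l , refl) = F≡G-inner u-inner (InnerVertex.isolated l (off-path _) (off-path _))
      ... | no ¬inner = let j , fj≡u = f-covers u ¬inner in
        subst (λ w → F w ≡ G w) fj≡u (F≡G-old j (old-edges i j (fi≢v₀ ∘ proj₁) (fi≢v₅ ∘ proj₁)))

    -- the rows of an end f i differ at its inner neighbour a (edge removed) and at the other end f j (edge added)
    end-row : ∀ {x y} → x ∘ f ≗ y → ∀ i j {a t} → adj Γ′ i j ≡ just σ →
              adj Γ (f i) a ≡ just t → adj Γ (f i) (f j) ≡ nothing → Inner v a →
              (∀ {u} → Inner v u → u ≢ a → adj Γ (f i) u ≡ nothing) →
              (∀ j′ → j′ ≢ j → adj Γ′ i j′ ≡ adj Γ (f i) (f j′)) →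
              ⟦ t ⟧ * x a ≡ ⟦ σ ⟧ * x (f j) → row (adj Γ) (f i) x ≡ row (adj Γ′) i y
    end-row {x} {y} agree i j {a} {t} i~j fi~a fi≁fj a-inner fi≁inner old transmitted = +-cancelʳ (⟦ σ ⟧ * x (f j)) _ _ (begin
      ∑ F + ⟦ σ ⟧ * x (f j)           ≡⟨ cong (∑ F +_) (sym (ℚₚ.+-identityˡ (⟦ σ ⟧ * x (f j)))) ⟩
      ∑ F + (0ℚ + ⟦ σ ⟧ * x (f j))    ≡⟨ cong (λ g → ∑ F + (g + ⟦ σ ⟧ * x (f j))) (sym (G-inner a-inner)) ⟩
      ∑ F + (G a + ⟦ σ ⟧ * x (f j))   ≡⟨ cong (λ g → ∑ F + (G a + g)) (trans (cong (λ e → entry e * x (f j)) (sym i~j))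
                                                                            (sym (G-image j))) ⟩
      ∑ F + (G a + G (f j))           ≡⟨ ∑-agree-except₂ a≢fj F≡G ⟩
      ∑ G + (F a + F (f j))           ≡⟨ cong₂ (λ g h → g + (h + F (f j))) ∑G (cong (λ e → entry e * x a) fi~a) ⟩
      row (adj Γ′) i y + (⟦ t ⟧ * x a + F (f j)) ≡⟨ cong (λ h → row (adj Γ′) i y + (⟦ t ⟧ * x a + h))
                                                       (trans (cong (λ e → entry e * x (f j)) fi≁fj) (ℚₚ.*-zeroˡ (x (f j)))) ⟩
      row (adj Γ′) i y + (⟦ t ⟧ * x a + 0ℚ) ≡⟨ cong (row (adj Γ′) i y +_) (trans (ℚₚ.+-identityʳ (⟦ t ⟧ * x a)) transmitted) ⟩
      row (adj Γ′) i y + ⟦ σ ⟧ * x (f j) ∎)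
      where
      open ≡-Reasoning
      open Compare {x} {y} agree i
      a≢fj : a ≢ f j
      a≢fj a≡fj = f-avoids-inner j (subst (Inner v) a≡fj a-inner)
      F≡G : ∀ u → u ≢ a → u ≢ f j → F u ≡ G u
      F≡G u u≢a u≢fj with inner? u
      ... | yes u-inner = F≡G-inner u-inner (fi≁inner u-inner u≢a)
      ... | no ¬inner = let j′ , fj′≡u = f-covers u ¬inner in
        subst (λ w → F w ≡ G w) fj′≡u (F≡G-old j′ (old j′ (λ j′≡j → u≢fj (trans (sym fj′≡u) (cong f j′≡j)))))

    first-row : ∀ {x y} → x ∘ f ≗ y → PathEquations s (x ∘ v) →
                ∀ {i} → f i ≡ v 0F → row (adj Γ) (f i) x ≡ row (adj Γ′) i y
    first-row {x} agree eqs {i} fi≡v₀ =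
      end-row agree i j₅ (new-edge i j₅ fi≡v₀ fj₅≡v₅) (at-v₀ (path-edge 0F))
        (at-v₀ (trans (cong (adj Γ (v 0F)) fj₅≡v₅) ends-apart)) (0F , refl) (λ u-inner → at-v₀ ∘ first-isolated u-inner)
        (λ j′ j′≢j₅ → old-edges i j′ (λ (_ , fj′≡v₅) → j′≢j₅ (f-inj (trans fj′≡v₅ (sym fj₅≡v₅))))
                                       (λ (fi≡v₅ , _) → v-distinct (λ ()) (trans (sym fi≡v₀) fi≡v₅)))
        (trans (path-end₀ s {x ∘ v} eqs) (cong (λ w → ⟦ σ ⟧ * x w) (sym fj₅≡v₅)))
      where
      j₅ = proj₁ last-preimage
      fj₅≡v₅ = proj₂ last-preimage
      at-v₀ : ∀ {w e} → adj Γ (v 0F) w ≡ e → adj Γ (f i) w ≡ e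
      at-v₀ {w} = trans (cong (λ u → adj Γ u w) fi≡v₀)

    last-row : ∀ {x y} → x ∘ f ≗ y → PathEquations s (x ∘ v) →
               ∀ {i} → f i ≡ v 5F → row (adj Γ) (f i) x ≡ row (adj Γ′) i y
    last-row {x} agree eqs {i} fi≡v₅ =
      end-row agree i j₀ (trans (adj-sym Γ′ i j₀) (new-edge j₀ i fj₀≡v₀ fi≡v₅))
        (at-v₅ (trans (adj-sym Γ (v 5F) (v 4F)) (path-edge 4F)))
        (at-v₅ (trans (adj-sym Γ (v 5F) (f j₀)) (trans (cong (λ u → adj Γ u (v 5F)) fj₀≡v₀) ends-apart)))
        (3F , refl) (λ u-inner → at-v₅ ∘ last-isolated u-inner)
        (λ j′ j′≢j₀ → old-edges i j′ (λ (fi≡v₀ , _) → v-distinct (λ ()) (trans (sym fi≡v₀) fi≡v₅))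
                                       (λ (_ , fj′≡v₀) → j′≢j₀ (f-inj (trans fj′≡v₀ (sym fj₀≡v₀)))))
        (trans (path-end₅ s {x ∘ v} eqs) (cong (λ w → ⟦ σ ⟧ * x w) (sym fj₀≡v₀)))
      where
      j₀ = proj₁ first-preimage
      fj₀≡v₀ = proj₂ first-preimage
      at-v₅ : ∀ {w e} → adj Γ (v 5F) w ≡ e → adj Γ (f i) w ≡ e
      at-v₅ {w} = trans (cong (λ u → adj Γ u w) fi≡v₅)

  rows-agree : ∀ {x y} → x ∘ f ≗ y → PathEquations s (x ∘ v) → ∀ i → row (adj Γ) (f i) x ≡ row (adj Γ′) i y
  rows-agree agree eqs i with f i Finₚ.≟ v 0F | f i Finₚ.≟ v 5F
  ... | yes fi≡v₀ | _         = first-row agree eqs fi≡v₀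
  ... | no _      | yes fi≡v₅ = last-row agree eqs fi≡v₅
  ... | no fi≢v₀  | no fi≢v₅  = kept-row agree i fi≢v₀ fi≢v₅

  private
    restriction-injective : ∀ {x} → InKernel (adj Γ) x → x ∘ f ≗ const 0ℚ → x ≗ const 0ℚ
    restriction-injective {x} x-kernel x∘f≗0 u with inner? u
    ... | yes (l , refl) = path-vanishes s {x ∘ v} (kernel⇒path x-kernel) (at first-preimage) (at last-preimage) (suc (inject₁ l))
      where
      at : ∀ {w} → ∃ (λ i → f i ≡ w) → x w ≡ 0ℚ
      at (i , refl) = x∘f≗0 i
    ... | no ¬inner = let j , fj≡u = f-covers u ¬inner in trans (cong x (sym fj≡u)) (x∘f≗0 j)

    restriction-surjective : ∀ {y} → InKernel (adj Γ′) y → ∃ λ x → InKernel (adj Γ) x × x ∘ f ≗ y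
    restriction-surjective {y} y-kernel = x , x-kernel , x∘f≗y
      where
      z : Vector ℚ 6
      z = pathValues s (y (proj₁ first-preimage)) (y (proj₁ last-preimage))

      x : Vector ℚ n
      x = extend Finₚ._≟_ f y (extend Finₚ._≟_ v z (const 0ℚ))

      x∘f≗y : x ∘ f ≗ y
      x∘f≗y = extend-image Finₚ._≟_ f-inj y _

      inner-value : ∀ l → x (v (suc (inject₁ l))) ≡ z (suc (inject₁ l))
      inner-value l = trans (extend-outside Finₚ._≟_ f y _ (λ j fj≡ → f-avoids-inner j (l , fj≡)))
                            (extend-image Finₚ._≟_ v-inj z _ (suc (inject₁ l)))

      x∘v≗z : x ∘ v ≗ z
      x∘v≗z 0F = trans (cong x (sym (proj₂ first-preimage))) (x∘f≗y (proj₁ first-preimage))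
      x∘v≗z 1F = inner-value 0F
      x∘v≗z 2F = inner-value 1F
      x∘v≗z 3F = inner-value 2F
      x∘v≗z 4F = inner-value 3F
      x∘v≗z 5F = trans (cong x (sym (proj₂ last-preimage))) (x∘f≗y (proj₁ last-preimage))

      eqs : PathEquations s (x ∘ v)
      eqs l = trans (cong₂ (λ a b → ⟦ s (inject₁ l) ⟧ * a + ⟦ s (suc l) ⟧ * b) (x∘v≗z _) (x∘v≗z _))
                    (pathValues-equations s _ _ l)

      x-kernel : InKernel (adj Γ) x
      x-kernel u with inner? u
      ... | yes (l , refl) = path⇒inner-rows eqs l
      ... | no ¬inner = let j , fj≡u = f-covers u ¬inner in
        trans (cong (λ w → row (adj Γ) w x) (sym fj≡u)) (trans (rows-agree x∘f≗y eqs j) (y-kernel j))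

  isomorphism : KernelIsomorphism (adj Γ) (adj Γ′)
  isomorphism = record
    { to            = _∘ f
    ; to-cong       = λ x≗x′ → x≗x′ ∘ f
    ; to-linear     = λ _ _ _ → refl
    ; to-kernel     = λ x-kernel i → trans (sym (rows-agree (λ _ → refl) (kernel⇒path x-kernel) i)) (x-kernel (f i))
    ; to-injective  = restriction-injective
    ; to-surjective = restriction-surjective
    }

part1 : Part1
part1 Γ v v-inj s path-edge inner-degree ends-apart Γ′ f f-inj f-avoids-inner f-covers new-edge old-edges =
  sameNullity (PathContraction.isomorphism Γ v v-inj s path-edge inner-degree ends-apart Γ′ f f-inj f-avoids-inner f-covers new-edge old-edges)

Removed : (Fin (3 ℕ.+ k) → Fin n) → Fin (3 ℕ.+ k) → Fin n → Set
Removed c p x = ∃ λ i → i ≢ p × x ≡ c i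

quadrangle : (Fin 4 → Sign) → RawSigned 4
quadrangle s = cycleAdj (λ i → just (s i))

quadrangle-sym : ∀ s (q : Fin 3) → quadrangle s 0F (suc q) ≡ quadrangle s (suc q) 0F
quadrangle-sym s 0F = refl
quadrangle-sym s 1F = refl
quadrangle-sym s 2F = refl

module CycleReplacement
  (Γ : SignedGraph n) (c : Fin (3 ℕ.+ k) → Fin n) (c-inj : Injective _≡_ _≡_ c)
  (cycle-edge : ∀ i → adj Γ (c i) (c (next i)) ≢ nothing) (p : Fin (3 ℕ.+ k))
  (cycle-degree : ∀ i → i ≢ p → deg Γ (c i) < 3)
  (cycle-nullity : IsNullity (cycleAdj (λ i → adj Γ (c i) (c (next i)))) 2) (s : Fin 4 → Sign)
  (Γ′ : SignedGraph m) (h : Fin m → Fin n ⊎ Fin 3) (h-inj : Injective _≡_ _≡_ h)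
  (h-keeps : ∀ i x → h i ≡ inj₁ x → ¬ Removed c p x)
  (h-covers : ∀ x → ¬ Removed c p x → ∃ λ i → h i ≡ inj₁ x)
  (h-covers-new : ∀ (q : Fin 3) → ∃ λ i → h i ≡ inj₂ q)
  (old-edges : ∀ i j x y → h i ≡ inj₁ x → h j ≡ inj₁ y → adj Γ′ i j ≡ adj Γ x y)
  (hub-edges : ∀ i j q → h i ≡ inj₁ (c p) → h j ≡ inj₂ q → adj Γ′ i j ≡ quadrangle s 0F (suc q))
  (no-edges : ∀ i j x q → h i ≡ inj₁ x → x ≢ c p → h j ≡ inj₂ q → adj Γ′ i j ≡ nothing)
  (new-edges : ∀ i j q r → h i ≡ inj₂ q → h j ≡ inj₂ r → adj Γ′ i j ≡ quadrangle s (suc q) (suc r))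
  (quadrangle-nullity : IsNullity (quadrangle s) 2)
  where

  private
    e : Fin (3 ℕ.+ k) → Maybe Sign
    e i = adj Γ (c i) (c (next i))

    C = cycleAdj e
    Q = quadrangle s
    hub = c p

    module Cycle = NullityTwoCycle e cycle-edge cycle-nullity p
    module Quad  = NullityTwoCycle (λ i → just (s i)) (λ _ ()) quadrangle-nullity 0F

    hub-kept : ¬ Removed c p hub
    hub-kept (i , i≢p , hub≡ci) = i≢p (c-inj (sym hub≡ci))

    hub′ : Fin m
    hub′ = proj₁ (h-covers hub hub-kept)

    new : Fin 3 → Fin m
    new q = proj₁ (h-covers-new q)

    quadValues : Vector ℚ m → Vector ℚ 4
    quadValues y 0F      = y hub′
    quadValues y (suc q) = y (new q)

    on-cycle? : ∀ u → Dec (∃ λ r → c r ≡ u)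
    on-cycle? u = Finₚ.any? (λ r → c r Finₚ.≟ u)

    adj-prev : ∀ i → adj Γ (c i) (c (prev i)) ≡ e (prev i)
    adj-prev i = trans (adj-sym Γ (c i) (c (prev i))) (cong (λ j → adj Γ (c (prev i)) (c j)) (sym (next-prev i)))

    module RemovedVertex (r : Fin (3 ℕ.+ k)) (r≢p : r ≢ p) where
      neighbours-differ : c (next r) ≢ c (prev r)
      neighbours-differ = next≢prev r ∘ c-inj

      prev-edge : adj Γ (c r) (c (prev r)) ≢ nothing
      prev-edge = subst (_≢ nothing) (sym (adj-prev r)) (cycle-edge (prev r))

      row-removed : ∀ x → row (adj Γ) (c r) x ≡ row C r (x ∘ c)
      row-removed x = trans (row-of-degree-two Γ (cycle-degree r r≢p) neighbours-differ (cycle-edge r) prev-edge x)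
        (trans (cong (λ t → entry (e r) * x (c (next r)) + entry t * x (c (prev r))) (adj-prev r)) (sym (cycle-row e r (x ∘ c))))

      isolated : ∀ {u} → u ≢ c (next r) → u ≢ c (prev r) → adj Γ u (c r) ≡ nothing
      isolated {u} u≢next u≢prev = trans (adj-sym Γ u (c r))
        (only-two-neighbours Γ (cycle-degree r r≢p) neighbours-differ (cycle-edge r) prev-edge u u≢next u≢prev)

    removed? : ∀ u → Dec (Removed c p u)
    removed? u = Finₚ.any? (λ r → ¬? (r Finₚ.≟ p) ×-dec (u Finₚ.≟ c r))

    hub′-eq : h hub′ ≡ inj₁ hub
    hub′-eq = proj₂ (h-covers hub hub-kept)

    new-eq : ∀ q → h (new q) ≡ inj₂ q
    new-eq q = proj₂ (h-covers-new q)

    module Terms (y : Vector ℚ m) (i : Fin m) where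

      G : Fin n ⊎ Fin 3 → ℚ
      G = push _≟⊎_ h (λ j → entry (adj Γ′ i j) * y j)

      row′-split : row (adj Γ′) i y ≡ ∑ (G ∘ inj₁) + ∑ (G ∘ inj₂)
      row′-split = sym (∑-push-⊎ h (λ j → entry (adj Γ′ i j) * y j))

      G-image : ∀ {j b} → h j ≡ b → G b ≡ entry (adj Γ′ i j) * y j
      G-image {j} refl = push-image _≟⊎_ h-inj _ j

      G-removed : ∀ {u} → Removed c p u → G (inj₁ u) ≡ 0ℚ
      G-removed {u} u-removed = push-outside _≟⊎_ h _ (λ j hj≡u → h-keeps j u hj≡u u-removed)

      G-nothing : ∀ {j b} → h j ≡ b → adj Γ′ i j ≡ nothing → G b ≡ 0ℚ
      G-nothing {j} hj≡b i≁j = trans (G-image hj≡b) (trans (cong (λ t → entry t * y j) i≁j) (ℚₚ.*-zeroˡ (y j)))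

  new-row : ∀ y q → row (adj Γ′) (new q) y ≡ row Q (suc q) (quadValues y)
  new-row y q = trans row′-split (cong₂ _+_ old-part new-part)
    where
    open Terms y (new q)
    only-hub : ∀ u → u ≢ hub → G (inj₁ u) ≡ 0ℚ
    only-hub u u≢hub with removed? u
    ... | yes u-removed = G-removed u-removed
    ... | no u-kept = let j , hj≡u = h-covers u u-kept in
      G-nothing hj≡u (trans (adj-sym Γ′ (new q) j) (no-edges j (new q) u q hj≡u u≢hub (new-eq q)))
    old-part : ∑ (G ∘ inj₁) ≡ entry (Q (suc q) 0F) * y hub′
    old-part = trans (∑-single hub only-hub) (trans (G-image hub′-eq) (cong (λ t → entry t * y hub′)
      (trans (adj-sym Γ′ (new q) hub′) (trans (hub-edges hub′ (new q) q hub′-eq (new-eq q)) (quadrangle-sym s q)))))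
    new-part : ∑ (G ∘ inj₂) ≡ ∑ λ r → entry (Q (suc q) (suc r)) * y (new r)
    new-part = ∑-cong λ r → trans (G-image (new-eq r))
      (cong (λ t → entry t * y (new r)) (new-edges (new q) (new r) q r (new-eq q) (new-eq r)))

  private
    Agree : Vector ℚ n → Vector ℚ m → Set
    Agree x y = ∀ i u → h i ≡ inj₁ u → x u ≡ y i

    module Compare {x : Vector ℚ n} {y : Vector ℚ m} (agree : Agree x y) {i : Fin m} {u : Fin n} (hi≡u : h i ≡ inj₁ u) where
      open Terms y i public

      F : Vector ℚ n
      F u′ = entry (adj Γ u u′) * x u′

      F≡G-kept : ∀ {u′} → ¬ Removed c p u′ → F u′ ≡ G (inj₁ u′)
      F≡G-kept {u′} u′-kept = let j , hj≡u′ = h-covers u′ u′-kept in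
        trans (cong₂ (λ t z → entry t * z) (sym (old-edges i j u u′ hi≡u hj≡u′)) (agree j u′ hj≡u′)) (sym (G-image hj≡u′))

      F≡G-removed : ∀ {r} → r ≢ p → u ≢ c (next r) → u ≢ c (prev r) → F (c r) ≡ G (inj₁ (c r))
      F≡G-removed {r} r≢p u≢next u≢prev = trans (cong (λ t → entry t * x (c r)) (RemovedVertex.isolated r r≢p u≢next u≢prev))
        (trans (ℚₚ.*-zeroˡ (x (c r))) (sym (G-removed (r , r≢p , refl))))

    outer-row : ∀ {x y} → Agree x y → ∀ {i u} → h i ≡ inj₁ u → (∀ r → c r ≢ u) → row (adj Γ) u x ≡ row (adj Γ′) i y
    outer-row {x} {y} agree {i} {u} hi≡u off-cycle = begin
      ∑ F                             ≡⟨ ∑-cong F≡G ⟩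
      ∑ (G ∘ inj₁)                    ≡⟨ ℚₚ.+-identityʳ _ ⟨
      ∑ (G ∘ inj₁) + 0ℚ               ≡⟨ cong (∑ (G ∘ inj₁) +_) (∑-zero no-new-neighbours) ⟨
      ∑ (G ∘ inj₁) + ∑ (G ∘ inj₂)     ≡⟨ row′-split ⟨
      row (adj Γ′) i y                ∎
      where
      open ≡-Reasoning
      open Compare agree hi≡u
      F≡G : ∀ u′ → F u′ ≡ G (inj₁ u′)
      F≡G u′ with removed? u′
      ... | yes (r , r≢p , refl) = F≡G-removed r≢p (off-cycle (next r) ∘ sym) (off-cycle (prev r) ∘ sym)
      ... | no u′-kept = F≡G-kept u′-kept
      no-new-neighbours : ∀ q → G (inj₂ q) ≡ 0ℚ
      no-new-neighbours q = G-nothing (new-eq q) (no-edges i (new q) u q hi≡u (off-cycle p ∘ sym) (new-eq q))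

    hub-row : ∀ {x y} → Agree x y → row Q 0F (quadValues y) ≡ 0ℚ → row C p (x ∘ c) ≡ 0ℚ →
              ∀ {i} → h i ≡ inj₁ hub → row (adj Γ) hub x ≡ row (adj Γ′) i y
    hub-row {x} {y} agree quad-row cycle-row-p {i} hi≡hub = begin
      ∑ F                                     ≡⟨ ℚₚ.+-identityʳ _ ⟨
      ∑ F + 0ℚ                                ≡⟨ cong (∑ F +_) (sym (ℚₚ.+-identityˡ 0ℚ)) ⟩
      ∑ F + (0ℚ + 0ℚ)                         ≡⟨ cong₂ (λ s t → ∑ F + (s + t)) (G-removed (next p , next≢id p , refl))
                                                                             (G-removed (prev p , prev≢id p , refl)) ⟨
      ∑ F + (G (inj₁ a) + G (inj₁ b))         ≡⟨ ∑-agree-except₂ a≢b F≡G ⟩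
      ∑ (G ∘ inj₁) + (F a + F b)              ≡⟨ cong (∑ (G ∘ inj₁) +_) (trans cycle-terms cycle-row-p) ⟩
      ∑ (G ∘ inj₁) + 0ℚ                       ≡⟨ cong (∑ (G ∘ inj₁) +_) (trans (sym quad-row) quad-terms) ⟩
      ∑ (G ∘ inj₁) + ∑ (G ∘ inj₂)             ≡⟨ row′-split ⟨
      row (adj Γ′) i y                        ∎
      where
      open ≡-Reasoning
      open Compare agree hi≡hub
      a = c (next p)
      b = c (prev p)
      a≢b : a ≢ b
      a≢b = next≢prev p ∘ c-inj
      cycle-terms : F a + F b ≡ row C p (x ∘ c)
      cycle-terms = trans (cong (λ t → F a + entry t * x b) (adj-prev p)) (sym (cycle-row e p (x ∘ c)))
      quad-terms : row Q 0F (quadValues y) ≡ ∑ (G ∘ inj₂)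
      quad-terms = trans (cong (_+ ∑ (λ q → entry (Q 0F (suc q)) * y (new q))) (ℚₚ.*-zeroˡ (y hub′)))
        (trans (ℚₚ.+-identityˡ (∑ (λ q → entry (Q 0F (suc q)) * y (new q)))) (∑-cong λ q →
        sym (trans (G-image (new-eq q)) (cong (λ t → entry t * y (new q)) (hub-edges i (new q) q hi≡hub (new-eq q))))))
      F≡G : ∀ u′ → u′ ≢ a → u′ ≢ b → F u′ ≡ G (inj₁ u′)
      F≡G u′ u′≢a u′≢b with removed? u′
      ... | yes (r , r≢p , refl) = F≡G-removed r≢p
              (λ hub≡ → u′≢b (cong c (trans (sym (prev-next r)) (cong prev (sym (c-inj hub≡))))))
              (λ hub≡ → u′≢a (cong c (trans (sym (next-prev r)) (cong next (sym (c-inj hub≡))))))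
      ... | no u′-kept = F≡G-kept u′-kept

  kept-row : ∀ {x y} → Agree x y → row Q 0F (quadValues y) ≡ 0ℚ → row C p (x ∘ c) ≡ 0ℚ →
             ∀ {i u} → h i ≡ inj₁ u → row (adj Γ) u x ≡ row (adj Γ′) i y
  kept-row agree quad-row cycle-row-p {i} {u} hi≡u with on-cycle? u
  ... | no off-cycle = outer-row agree hi≡u (λ r cr≡u → off-cycle (r , cr≡u))
  ... | yes (r , refl) with r Finₚ.≟ p
  ...   | yes refl = hub-row agree quad-row cycle-row-p hi≡u
  ...   | no r≢p   = contradiction (r , r≢p , refl) (h-keeps i (c r) hi≡u)

  private
    quadExtension : Vector ℚ n → Vector ℚ 4
    quadExtension x = Quad.extension (x hub) (x (c (next p)))

    -- the first new vertex takes over the role of the successor of the hub on the cycle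
    value : Vector ℚ n → Fin n ⊎ Fin 3 → ℚ
    value x (inj₁ u) = x u
    value x (inj₂ q) = quadExtension x (suc q)

    to : Vector ℚ n → Vector ℚ m
    to x i = value x (h i)

    to-agree : ∀ x → Agree x (to x)
    to-agree x i u hi≡u = cong (value x) (sym hi≡u)

    quadValues-to : ∀ x → quadValues (to x) ≗ quadExtension x
    quadValues-to x 0F      = trans (sym (to-agree x hub′ hub hub′-eq)) (sym (Quad.extension-at-p (x hub) (x (c (next p)))))
    quadValues-to x (suc q) = cong (value x) (new-eq q)

    value-linear : ∀ {l} (a : Vector ℚ l) u b → value (combination a u) b ≡ ∑ λ j → a j * value (u j) b
    value-linear a u (inj₁ _) = refl
    value-linear a u (inj₂ q) = Quad.extension-linear a (λ j → u j hub) (λ j → u j (c (next p))) (suc q)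

    to-kernel : ∀ {x} → InKernel (adj Γ) x → InKernel (adj Γ′) (to x)
    to-kernel {x} x-kernel i with h i in hi≡
    ... | inj₁ u = trans (sym (kept-row (to-agree x) quad-row cycle-row-p hi≡)) (x-kernel u)
      where
      quad-row = trans (row-cong Q 0F {quadValues (to x)} (quadValues-to x)) (Quad.extension-kernel (x hub) (x (c (next p))) 0F)
      cycle-row-p = Cycle.kernel-closure {x ∘ c} (λ r r≢p → trans (sym (RemovedVertex.row-removed r r≢p x)) (x-kernel (c r))) p
    ... | inj₂ q = begin
      row (adj Γ′) i (to x)                       ≡⟨ cong (λ j → row (adj Γ′) j (to x)) (h-inj (trans hi≡ (sym (new-eq q)))) ⟩
      row (adj Γ′) (new q) (to x)                 ≡⟨ new-row (to x) q ⟩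
      row Q (suc q) (quadValues (to x))           ≡⟨ row-cong Q (suc q) (quadValues-to x) ⟩
      row Q (suc q) (quadExtension x)             ≡⟨ Quad.extension-kernel (x hub) (x (c (next p))) (suc q) ⟩
      0ℚ                                          ∎
      where open ≡-Reasoning

    cycle-rows : ∀ {x} → InKernel (adj Γ) x → ∀ r → r ≢ p → row C r (x ∘ c) ≡ 0ℚ
    cycle-rows {x} x-kernel r r≢p = trans (sym (RemovedVertex.row-removed r r≢p x)) (x-kernel (c r))

    to-injective : ∀ {x} → InKernel (adj Γ) x → to x ≗ const 0ℚ → x ≗ const 0ℚ
    to-injective {x} x-kernel to-x≗0 u with removed? u
    ... | yes (r , _ , refl) = x∘c≗0 r
      where
      hub≡0 : x hub ≡ 0ℚ
      hub≡0 = trans (to-agree x hub′ hub hub′-eq) (to-x≗0 hub′)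
      next≡0 : x (c (next p)) ≡ 0ℚ
      next≡0 = trans (sym (Quad.extension-at-next (x hub) (x (c (next p))))) (trans (cong (value x) (sym (new-eq 0F))) (to-x≗0 (new 0F)))
      x∘c≗0 : x ∘ c ≗ const 0ℚ
      x∘c≗0 = cycle-unique e cycle-edge p (cycle-rows x-kernel) (λ r _ → row-zero C r) hub≡0 next≡0
    ... | no u-kept = let j , hj≡u = h-covers u u-kept in trans (to-agree x j u hj≡u) (to-x≗0 j)

    module Preimage {y : Vector ℚ m} (y-kernel : InKernel (adj Γ′) y) where

      z : Vector ℚ (3 ℕ.+ k)
      z = Cycle.extension (y hub′) (y (new 0F))

      default : Fin n ⊎ Fin 3 → ℚ
      default (inj₁ u) = extend Finₚ._≟_ c z (const 0ℚ) u
      default (inj₂ _) = 0ℚ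

      x : Vector ℚ n
      x u = extend _≟⊎_ h y default (inj₁ u)

      agree : Agree x y
      agree i u hi≡u = trans (cong (extend _≟⊎_ h y default) (sym hi≡u)) (extend-image _≟⊎_ h-inj y default i)

      x∘c≗z : x ∘ c ≗ z
      x∘c≗z r = by-cases (r Finₚ.≟ p)
        where
        by-cases : Dec (r ≡ p) → x (c r) ≡ z r
        by-cases (yes r≡p) = subst (λ t → x (c t) ≡ z t) (sym r≡p)
          (trans (agree hub′ hub hub′-eq) (sym (Cycle.extension-at-p (y hub′) (y (new 0F)))))
        by-cases (no r≢p) = trans (extend-outside _≟⊎_ h y default (λ j hj≡ → h-keeps j (c r) hj≡ (r , r≢p , refl)))
                                  (extend-image Finₚ._≟_ c-inj z (const 0ℚ) r)

      quad-kernel : InKernel Q (quadValues y)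
      quad-kernel = Quad.kernel-closure {quadValues y} λ where
        0F      0≢0 → contradiction refl 0≢0
        (suc q) _   → trans (sym (new-row y q)) (y-kernel (new q))

      cycle-kernel : InKernel C (x ∘ c)
      cycle-kernel r = trans (row-cong C r x∘c≗z) (Cycle.extension-kernel (y hub′) (y (new 0F)) r)

      x-kernel : InKernel (adj Γ) x
      x-kernel u = by-cases (removed? u)
        where
        by-cases : Dec (Removed c p u) → row (adj Γ) u x ≡ 0ℚ
        by-cases (yes (r , r≢p , u≡cr)) = subst (λ t → row (adj Γ) t x ≡ 0ℚ) (sym u≡cr)
          (trans (RemovedVertex.row-removed r r≢p x) (cycle-kernel r))
        by-cases (no u-kept) = let j , hj≡u = h-covers u u-kept in
          trans (kept-row agree (quad-kernel 0F) (cycle-kernel p) hj≡u) (y-kernel j)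

      to-x≗y : to x ≗ y
      to-x≗y i = at (h i) refl
        where
        open ≡-Reasoning
        at : ∀ b → h i ≡ b → value x b ≡ y i
        at (inj₁ u) hi≡ = agree i u hi≡
        at (inj₂ q) hi≡ = begin
          Quad.extension (x hub) (x (c (next p))) (suc q)   ≡⟨ cong₂ (λ α β → Quad.extension α β (suc q)) (agree hub′ hub hub′-eq)
                                                                  (trans (x∘c≗z (next p)) (Cycle.extension-at-next (y hub′) (y (new 0F)))) ⟩
          Quad.extension (y hub′) (y (new 0F)) (suc q)      ≡⟨ Quad.extension-unique {quadValues y} (λ t _ → quad-kernel t) (suc q) ⟨
          y (new q)                                         ≡⟨ cong y (h-inj (trans (new-eq q) (sym hi≡))) ⟩
          y i                                               ∎

    to-surjective : ∀ {y} → InKernel (adj Γ′) y → ∃ λ x → InKernel (adj Γ) x × to x ≗ y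
    to-surjective y-kernel = x , x-kernel , to-x≗y
      where open Preimage y-kernel

  isomorphism : KernelIsomorphism (adj Γ) (adj Γ′)
  isomorphism = record
    { to            = to
    ; to-cong       = λ x≗x′ i → value-cong x≗x′ (h i)
    ; to-linear     = λ a u i → value-linear a u (h i)
    ; to-kernel     = to-kernel
    ; to-injective  = to-injective
    ; to-surjective = to-surjective
    }
    where
    value-cong : ∀ {x x′} → x ≗ x′ → ∀ b → value x b ≡ value x′ b
    value-cong x≗x′ (inj₁ u) = x≗x′ u
    value-cong x≗x′ (inj₂ q) = cong₂ (λ α β → Quad.extension α β (suc q)) (x≗x′ hub) (x≗x′ (c (next p)))

part2 : Part2
part2 Γ k c c-inj cycle-edge p _ cycle-degree cycle-nullity s Γ′ h h-inj h-keeps h-covers h-covers-new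
      old-edges hub-edges no-edges new-edges quadrangle-nullity =
  sameNullity (CycleReplacement.isomorphism Γ c c-inj cycle-edge p cycle-degree cycle-nullity s Γ′ h h-inj
                 h-keeps h-covers h-covers-new old-edges hub-edges no-edges new-edges quadrangle-nullity)

lemma4p1 : Part1 × Part2
lemma4p1 = part1 , part2
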